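{- For every positive integer $k$ and all nonnegative integers $p_1,p_2$, $$\sum_{i=1}^{k-1} i^{p_1}(k-i)^{p_2}=\sum_{\substack{i,j\geqslant 0\\ p_1\leqslant i+j\leqslant p_1+p_2}}(-1)^{j+p_1}\binom{i+j}{i}\binom{p_2}{i+j-p_1}\frac{B_i}{j+1}(k-1)^{j+1}k^{p_1+p_2-i-j}.$$ In particular, the right-hand side is a polynomial in $k$ with rational coefficients of degree exactly $p_1+p_2+1$.
   Context: $B_i$ are the Bernoulli numbers, $\sum_{i\geqslant0}\frac{B_i}{i!}t^i=\frac{t}{e^t-1}$ (so $B_1=-\frac12$). -}

module Defs where

open import Data.Nat as ℕ using (ℕ; zero; suc; _∸_; _≤ᵇ_)
open import Data.Nat.Combinatorics using (_C_)
open import Data.Bool using (if_then_else_; _∧_)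
open import Data.Integer using (+_)
open import Data.Rational using (ℚ; 0ℚ; 1ℚ; _+_; _*_; -_; _/_)

ℕ→ℚ : ℕ → ℚ
ℕ→ℚ n = (+ n) / 1

infixr 8 _^ᵠ_
_^ᵠ_ : ℚ → ℕ → ℚ
x ^ᵠ zero  = 1ℚ
x ^ᵠ suc n = x * (x ^ᵠ n)

sgn : ℕ → ℚ
sgn zero    = 1ℚ
sgn (suc n) = - sgn n

-- Σ_{i=a}^{b} f i  (empty, i.e. 0, if b < a)
-- implemented as Σ_{t < b+1-a} f (a+t)
sumBelow : ℕ → (ℕ → ℚ) → ℚ
sumBelow zero    f = 0ℚ
sumBelow (suc n) f = sumBelow n f + f n

sumFromTo : ℕ → ℕ → (ℕ → ℚ) → ℚ
sumFromTo a b f = sumBelow (suc b ∸ a) (λ t → f (a ℕ.+ t))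

-- Bernoulli numbers, convention B₁ = -1/2, via the recurrence equivalent to
-- Σ B_i t^i / i! = t/(e^t - 1):
--   B₀ = 1,   Σ_{m=0}^{n} C(n+1,m) B_m = 0  for n ≥ 1,
-- i.e. B_n = -1/(n+1) Σ_{m<n} C(n+1,m) B_m.
-- bernUpTo n = λ m → B_m for m ≤ n (values for m > n are junk).
bernUpTo : ℕ → (ℕ → ℚ)
bernUpTo zero m = 1ℚ
bernUpTo (suc n) m =
  if m ≤ᵇ n then bernUpTo n m
  else - ((+ 1) / suc (suc n)) *
         sumBelow (suc n) (λ l → ℕ→ℚ (suc (suc n) C l) * bernUpTo n l)

B : ℕ → ℚ
B n = bernUpTo n n

LHS : ℕ → ℕ → ℕ → ℚ
LHS k p₁ p₂ = sumFromTo 1 (k ∸ 1) (λ i → ℕ→ℚ i ^ᵠ p₁ * ℕ→ℚ (k ∸ i) ^ᵠ p₂)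

-- right-hand side: sum over i, j ≥ 0 with p₁ ≤ i+j ≤ p₁+p₂ (both i, j are then
-- at most p₁+p₂, so ranging over 0..p₁+p₂ with the side condition is exact).
RHS : ℕ → ℕ → ℕ → ℚ
RHS k p₁ p₂ =
  sumFromTo 0 (p₁ ℕ.+ p₂) λ i →
  sumFromTo 0 (p₁ ℕ.+ p₂) λ j →
    if (p₁ ≤ᵇ i ℕ.+ j) ∧ (i ℕ.+ j ≤ᵇ p₁ ℕ.+ p₂)
    then sgn (j ℕ.+ p₁) * ℕ→ℚ ((i ℕ.+ j) C i) * ℕ→ℚ (p₂ C (i ℕ.+ j ∸ p₁))
         * (B i * ((+ 1) / suc j))
         * (ℕ→ℚ (k ∸ 1)) ^ᵠ (suc j) * (ℕ→ℚ k) ^ᵠ (p₁ ℕ.+ p₂ ∸ (i ℕ.+ j))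
    else 0ℚ

evalPoly : ℕ → (ℕ → ℚ) → ℚ → ℚ
evalPoly d c x = sumFromTo 0 d (λ m → c m * x ^ᵠ m)

module Submission where

-- Both sides satisfy  S(p₁, p₂+1) = K·S(p₁, p₂) - S(p₁+1, p₂):  the left side because
-- (K-i)^(p₂+1) = K (K-i)^p₂ - i (K-i)^p₂, the right side summand by summand, since its
-- p₂-dependence is the pattern (-1)^p₁ C(p₂, s-p₁) K^(p₂-(s-p₁)) (s = i + j), which obeys
-- Pascal's rule.  So by induction on p₂ it suffices to treat p₂ = 0.  There only the diagonal i + j = p₁ survives and the right side
-- becomes (1/(p₁+1)) ∑_i C(p₁+1,i) (-1)^i B_i (K-1)^(p₁+1-i), which is Faulhaber's formula for
-- ∑_{t=1}^{K-1} t^p₁.  Faulhaber is proved by telescoping: F p x = ∑_i C(p+1,i) B_i x^(p+1-i)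
-- satisfies F p (x+1) - F p x = (p+1) x^p (binomial theorem, trinomial revision, an exchange of
-- a triangular double sum, and the Bernoulli recurrence), and the signed variant G p x is F
-- reflected at 0.  The polynomial claim follows from the same recurrence: coefficients are built
-- from those of the power sum, and the top one is p₁! p₂! / (p₁+p₂+1)! ≠ 0.

open import Defs
open import Level using (0ℓ)
open import Data.Bool using (true; false; if_then_else_; _∧_)
open import Data.Bool.Properties using (T-≡; ¬-not; ∧-zeroʳ; if-cong)
open import Data.Maybe using (Maybe)
open import Data.Nat as ℕ using (ℕ; zero; suc; _∸_; _≤ᵇ_; s≤s; _!)
import Data.Nat.Properties as ℕₚ
open import Data.Nat.DivMod using (m/n*n≡m)
open import Data.Nat.Combinatorics
  using (_C_; nCk+nC[k+1]≡[n+1]C[k+1]; k>n⇒nCk≡0; nCn≡1; nC1≡n; nCk≡nC[n∸k]; k![n∸k]!∣n!)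
open import Data.Nat.Combinatorics.Specification using (nCk≡n!/k![n-k]!)
import Data.Nat.Tactic.RingSolver as ℕ-Solver
import Data.Nat.Coprimality as Coprime
open import Data.Integer using () renaming (+_ to ⁺_)
import Data.Integer.Properties as ℤₚ
open import Data.Rational using (ℚ; 0ℚ; 1ℚ; _+_; _*_; -_; _-_; _/_; mkℚ; ↥_)
import Data.Rational.Properties as ℚₚ
open import Data.Product using (_×_; Σ; _,_)
open import Data.Sum using (inj₁; inj₂)
open import Data.Empty using (⊥-elim)
open import Function.Bundles using (Equivalence)
open import Relation.Nullary using (¬_; Dec; yes; no)
open import Relation.Nullary.Decidable using (dec⇒maybe)
open import Relation.Binary.PropositionalEquality
open import Relation.Binary.Definitions using (Tri; tri<; tri≈; tri>)
open import Tactic.RingSolver using (solve-∀)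
import Tactic.RingSolver.Core.AlmostCommutativeRing as ACR
open ≡-Reasoning

ℚ-ring : ACR.AlmostCommutativeRing 0ℓ 0ℓ
ℚ-ring = ACR.fromCommutativeRing ℚₚ.+-*-commutativeRing isZero
  where
  isZero : ∀ x → Maybe (0ℚ ≡ x)
  isZero x = dec⇒maybe (0ℚ ℚₚ.≟ x)

ℕ→ℚ≡mkℚ : ∀ n → ℕ→ℚ n ≡ mkℚ (⁺ n) 0 (Coprime.sym (Coprime.1-coprimeTo n))
ℕ→ℚ≡mkℚ n = ℚₚ.normalize-coprime _

ℕ→ℚ-+ : ∀ m n → ℕ→ℚ (m ℕ.+ n) ≡ ℕ→ℚ m + ℕ→ℚ n
ℕ→ℚ-+ m n rewrite ℕ→ℚ≡mkℚ m | ℕ→ℚ≡mkℚ n =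
  ℚₚ./-cong (cong₂ Data.Integer._+_ (sym (ℤₚ.*-identityʳ (⁺ m))) (sym (ℤₚ.*-identityʳ (⁺ n)))) refl

ℕ→ℚ-* : ∀ m n → ℕ→ℚ (m ℕ.* n) ≡ ℕ→ℚ m * ℕ→ℚ n
ℕ→ℚ-* m n rewrite ℕ→ℚ≡mkℚ m | ℕ→ℚ≡mkℚ n =
  ℚₚ./-cong {⁺ (m ℕ.* n)} {1} {⁺ m Data.Integer.* ⁺ n} {1} (ℤₚ.pos-* m n) refl

ℕ→ℚ-suc : ∀ n → ℕ→ℚ (suc n) ≡ ℕ→ℚ n + 1ℚ
ℕ→ℚ-suc n = trans (ℕ→ℚ-+ 1 n) (ℚₚ.+-comm 1ℚ (ℕ→ℚ n))

ℕ→ℚ-reflects-0 : ∀ n → ℕ→ℚ n ≡ 0ℚ → n ≡ 0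
ℕ→ℚ-reflects-0 n eq = ℤₚ.+-injective (cong ↥_ (trans (sym (ℕ→ℚ≡mkℚ n)) eq))

*-inverse-suc : ∀ m → ((⁺ 1) / suc m) * ℕ→ℚ (suc m) ≡ 1ℚ
*-inverse-suc m rewrite ℕ→ℚ≡mkℚ (suc m) | ℚₚ.normalize-coprime {1} {m} (Coprime.1-coprimeTo (suc m)) =
  ℚₚ.*-inverseˡ (mkℚ (⁺ suc m) 0 (Coprime.sym (Coprime.1-coprimeTo (suc m))))

*-cancelˡ-suc : ∀ m {a b} → ℕ→ℚ (suc m) * a ≡ ℕ→ℚ (suc m) * b → a ≡ b
*-cancelˡ-suc m {a} {b} eq = begin
  a                     ≡⟨ rescale a ⟩
  v * (ℕ→ℚ (suc m) * a) ≡⟨ cong (v *_) eq ⟩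
  v * (ℕ→ℚ (suc m) * b) ≡⟨ sym (rescale b) ⟩
  b                     ∎
  where
  v = (⁺ 1) / suc m
  rescale : ∀ x → x ≡ v * (ℕ→ℚ (suc m) * x)
  rescale x = begin
    x                         ≡⟨ sym (ℚₚ.*-identityˡ x) ⟩
    1ℚ * x                    ≡⟨ cong (_* x) (sym (*-inverse-suc m)) ⟩
    v * ℕ→ℚ (suc m) * x       ≡⟨ ℚₚ.*-assoc v (ℕ→ℚ (suc m)) x ⟩
    v * (ℕ→ℚ (suc m) * x)     ∎

sgn-+ : ∀ m n → sgn (m ℕ.+ n) ≡ sgn m * sgn n
sgn-+ zero    n = sym (ℚₚ.*-identityˡ (sgn n))
sgn-+ (suc m) n = trans (cong -_ (sgn-+ m n)) (ℚₚ.neg-distribˡ-* (sgn m) (sgn n))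

sgn-square : ∀ n → sgn n * sgn n ≡ 1ℚ
sgn-square zero    = refl
sgn-square (suc n) = trans (ring (sgn n)) (sgn-square n)
  where
  ring : ∀ s → (- s) * (- s) ≡ s * s
  ring = solve-∀ ℚ-ring

sgn-∸ : ∀ {n i} → i ℕ.≤ n → sgn n * sgn (n ∸ i) ≡ sgn i
sgn-∸ {n} {i} i≤n = begin
  sgn n * sgn (n ∸ i)                  ≡⟨ cong (λ m → sgn m * sgn (n ∸ i)) (sym (ℕₚ.m+[n∸m]≡n i≤n)) ⟩
  sgn (i ℕ.+ (n ∸ i)) * sgn (n ∸ i)    ≡⟨ cong (_* sgn (n ∸ i)) (sgn-+ i (n ∸ i)) ⟩
  sgn i * sgn (n ∸ i) * sgn (n ∸ i)    ≡⟨ ℚₚ.*-assoc (sgn i) (sgn (n ∸ i)) (sgn (n ∸ i)) ⟩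
  sgn i * (sgn (n ∸ i) * sgn (n ∸ i))  ≡⟨ cong (sgn i *_) (sgn-square (n ∸ i)) ⟩
  sgn i * 1ℚ                           ≡⟨ ℚₚ.*-identityʳ (sgn i) ⟩
  sgn i                                ∎

neg-^ : ∀ x n → (- x) ^ᵠ n ≡ sgn n * x ^ᵠ n
neg-^ x zero    = refl
neg-^ x (suc n) = trans (cong ((- x) *_) (neg-^ x n)) (ring x (sgn n) (x ^ᵠ n))
  where
  ring : ∀ x s u → (- x) * (s * u) ≡ (- s) * (x * u)
  ring = solve-∀ ℚ-ring

≤ᵇ-true : ∀ {m n} → m ℕ.≤ n → (m ≤ᵇ n) ≡ true
≤ᵇ-true m≤n = Equivalence.to T-≡ (ℕₚ.≤⇒≤ᵇ m≤n)

≤ᵇ-false : ∀ {m n} → ¬ m ℕ.≤ n → (m ≤ᵇ n) ≡ false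
≤ᵇ-false {m} {n} m≰n = ¬-not (λ eq → m≰n (ℕₚ.≤ᵇ⇒≤ m n (Equivalence.from T-≡ eq)))

∑ : ℕ → (ℕ → ℚ) → ℚ
∑ = sumBelow

∑-cong : ∀ n {f g : ℕ → ℚ} → (∀ i → i ℕ.< n → f i ≡ g i) → ∑ n f ≡ ∑ n g
∑-cong zero    f≗g = refl
∑-cong (suc n) f≗g =
  cong₂ _+_ (∑-cong n (λ i i<n → f≗g i (ℕₚ.m<n⇒m<1+n i<n))) (f≗g n ℕₚ.≤-refl)

∑-zero : ∀ n {f : ℕ → ℚ} → (∀ i → i ℕ.< n → f i ≡ 0ℚ) → ∑ n f ≡ 0ℚ
∑-zero zero    f≗0 = refl
∑-zero (suc n) f≗0 =
  cong₂ _+_ (∑-zero n (λ i i<n → f≗0 i (ℕₚ.m<n⇒m<1+n i<n))) (f≗0 n ℕₚ.≤-refl)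

∑-+ : ∀ n (f g : ℕ → ℚ) → ∑ n (λ i → f i + g i) ≡ ∑ n f + ∑ n g
∑-+ zero    f g = refl
∑-+ (suc n) f g =
  trans (cong (_+ (f n + g n)) (∑-+ n f g)) (ring (∑ n f) (∑ n g) (f n) (g n))
  where
  ring : ∀ a b c d → (a + b) + (c + d) ≡ (a + c) + (b + d)
  ring = solve-∀ ℚ-ring

∑-*ˡ : ∀ n c (f : ℕ → ℚ) → c * ∑ n f ≡ ∑ n (λ i → c * f i)
∑-*ˡ zero    c f = ℚₚ.*-zeroʳ c
∑-*ˡ (suc n) c f = trans (ℚₚ.*-distribˡ-+ c _ _) (cong (_+ (c * f n)) (∑-*ˡ n c f))

∑-neg : ∀ n (f : ℕ → ℚ) → - ∑ n f ≡ ∑ n (λ i → - f i)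
∑-neg zero    f = refl
∑-neg (suc n) f = trans (ℚₚ.neg-distrib-+ (∑ n f) (f n)) (cong (_+ (- f n)) (∑-neg n f))

∑-linear : ∀ n c (f g : ℕ → ℚ) → ∑ n (λ i → c * f i - g i) ≡ c * ∑ n f - ∑ n g
∑-linear n c f g = begin
  ∑ n (λ i → c * f i - g i)          ≡⟨ ∑-+ n (λ i → c * f i) (λ i → - g i) ⟩
  ∑ n (λ i → c * f i) + ∑ n (λ i → - g i) ≡⟨ cong₂ _+_ (sym (∑-*ˡ n c f)) (sym (∑-neg n g)) ⟩
  c * ∑ n f - ∑ n g                  ∎

∑-shift : ∀ n (f : ℕ → ℚ) → ∑ (suc n) f ≡ f 0 + ∑ n (λ i → f (suc i))
∑-shift zero    f = trans (ℚₚ.+-identityˡ (f 0)) (sym (ℚₚ.+-identityʳ (f 0)))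
∑-shift (suc n) f =
  trans (cong (_+ f (suc n)) (∑-shift n f)) (ℚₚ.+-assoc (f 0) (∑ n (λ i → f (suc i))) (f (suc n)))

∑-reverse : ∀ n (f : ℕ → ℚ) → ∑ n f ≡ ∑ n (λ m → f (n ∸ suc m))
∑-reverse zero    f = refl
∑-reverse (suc n) f = begin
  ∑ n f + f n                       ≡⟨ cong (_+ f n) (∑-reverse n f) ⟩
  ∑ n (λ m → f (n ∸ suc m)) + f n   ≡⟨ ℚₚ.+-comm _ (f n) ⟩
  f n + ∑ n (λ m → f (n ∸ suc m))   ≡⟨ sym (∑-shift n (λ m → f (n ∸ m))) ⟩
  ∑ (suc n) (λ m → f (n ∸ m))       ∎

∑-single : ∀ n a (f : ℕ → ℚ) → a ℕ.< n → (∀ i → i ℕ.< n → i ≢ a → f i ≡ 0ℚ) → ∑ n f ≡ f a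
∑-single (suc n) a f a≤n f≗0 with ℕₚ.m≤n⇒m<n∨m≡n (ℕₚ.≤-pred a≤n)
... | inj₂ refl = trans
  (cong (_+ f a) (∑-zero a (λ i i<a → f≗0 i (ℕₚ.m<n⇒m<1+n i<a) (ℕₚ.<⇒≢ i<a))))
  (ℚₚ.+-identityˡ (f a))
... | inj₁ a<n = trans
  (cong₂ _+_ (∑-single n a f a<n (λ i i<n → f≗0 i (ℕₚ.m<n⇒m<1+n i<n)))
             (f≗0 n ℕₚ.≤-refl (λ n≡a → ℕₚ.<⇒≢ a<n (sym n≡a))))
  (ℚₚ.+-identityʳ (f a))

triangle : ℕ → (ℕ → ℕ → ℚ) → ℚ
triangle n f = ∑ n (λ i → ∑ (n ∸ i) (f i))

antidiagonal : ℕ → (ℕ → ℕ → ℚ) → ℚ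
antidiagonal n f = ∑ (suc n) (λ i → f i (n ∸ i))

triangle-suc : ∀ n f → triangle (suc n) f ≡ triangle n f + antidiagonal n f
triangle-suc n f = begin
  ∑ (suc n) (λ i → ∑ (suc n ∸ i) (f i))
    ≡⟨ ∑-cong (suc n) (λ i i≤n → cong (λ r → ∑ r (f i)) (ℕₚ.+-∸-assoc 1 (ℕₚ.≤-pred i≤n))) ⟩
  ∑ (suc n) (λ i → ∑ (n ∸ i) (f i) + f i (n ∸ i))
    ≡⟨ ∑-+ (suc n) (λ i → ∑ (n ∸ i) (f i)) (λ i → f i (n ∸ i)) ⟩
  triangle n f + ∑ (n ∸ n) (f n) + antidiagonal n f
    ≡⟨ cong (λ r → triangle n f + ∑ r (f n) + antidiagonal n f) (ℕₚ.n∸n≡0 n) ⟩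
  triangle n f + 0ℚ + antidiagonal n f
    ≡⟨ cong (_+ antidiagonal n f) (ℚₚ.+-identityʳ (triangle n f)) ⟩
  triangle n f + antidiagonal n f
    ∎

antidiagonal-transpose : ∀ n f → antidiagonal n f ≡ antidiagonal n (λ l i → f i l)
antidiagonal-transpose n f = begin
  ∑ (suc n) (λ i → f i (n ∸ i))             ≡⟨ ∑-reverse (suc n) (λ i → f i (n ∸ i)) ⟩
  ∑ (suc n) (λ m → f (n ∸ m) (n ∸ (n ∸ m))) ≡⟨ ∑-cong (suc n) (λ m m≤n → cong (f (n ∸ m)) (ℕₚ.m∸[m∸n]≡n (ℕₚ.≤-pred m≤n))) ⟩
  ∑ (suc n) (λ m → f (n ∸ m) m)             ∎

triangle-transpose : ∀ n f → triangle n f ≡ triangle n (λ l i → f i l)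
triangle-transpose zero    f = refl
triangle-transpose (suc n) f = begin
  triangle (suc n) f                                        ≡⟨ triangle-suc n f ⟩
  triangle n f + antidiagonal n f                           ≡⟨ cong₂ _+_ (triangle-transpose n f) (antidiagonal-transpose n f) ⟩
  triangle n (λ l i → f i l) + antidiagonal n (λ l i → f i l) ≡⟨ sym (triangle-suc n (λ l i → f i l)) ⟩
  triangle (suc n) (λ l i → f i l)                          ∎

square-shrink : ∀ n (f : ℕ → ℕ → ℚ) → (∀ i j → n ℕ.≤ i ℕ.+ j → f i j ≡ 0ℚ) →
  ∑ (suc n) (λ i → ∑ (suc n) (f i)) ≡ ∑ n (λ i → ∑ n (f i))
square-shrink n f f≗0 = begin
  ∑ n (λ i → ∑ n (f i) + f i n) + ∑ (suc n) (f n)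
    ≡⟨ cong₂ _+_ (∑-cong n (λ i _ → cong (∑ n (f i) +_) (f≗0 i n (ℕₚ.m≤n+m n i))))
                 (∑-zero (suc n) (λ j _ → f≗0 n j (ℕₚ.m≤m+n n j))) ⟩
  ∑ n (λ i → ∑ n (f i) + 0ℚ) + 0ℚ
    ≡⟨ trans (ℚₚ.+-identityʳ _) (∑-cong n (λ i _ → ℚₚ.+-identityʳ (∑ n (f i)))) ⟩
  ∑ n (λ i → ∑ n (f i))
    ∎

telescope : (D g : ℕ → ℚ) → D 0 ≡ 0ℚ → (∀ n → D (suc n) ≡ D n + g n) → ∀ n → D n ≡ ∑ n g
telescope D g D0 step zero    = D0
telescope D g D0 step (suc n) = trans (step n) (cong (_+ g n) (telescope D g D0 step n))

infix 10 _Cℚ_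
_Cℚ_ : ℕ → ℕ → ℚ
n Cℚ k = ℕ→ℚ (n C k)

pascal : ∀ n k → n Cℚ k + n Cℚ suc k ≡ suc n Cℚ suc k
pascal n k = trans (sym (ℕ→ℚ-+ (n C k) (n C suc k))) (cong ℕ→ℚ (nCk+nC[k+1]≡[n+1]C[k+1] n k))

-- The binomial theorem; the sum may run past the last nonzero term C(m,m) x^m.
binomial : ∀ {m n} x → m ℕ.< n → (x + 1ℚ) ^ᵠ m ≡ ∑ n (λ l → m Cℚ l * x ^ᵠ l)
binomial {zero} {suc n} x _ = sym (begin
  ∑ (suc n) (λ l → 0 Cℚ l * x ^ᵠ l)               ≡⟨ ∑-shift n (λ l → 0 Cℚ l * x ^ᵠ l) ⟩
  1ℚ * 1ℚ + ∑ n (λ l → 0 Cℚ suc l * x ^ᵠ suc l)   ≡⟨ cong (1ℚ * 1ℚ +_) (∑-zero n (λ l _ → ℚₚ.*-zeroˡ (x ^ᵠ suc l))) ⟩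
  1ℚ                                              ∎)
binomial {suc m} {suc n} x (s≤s m<n) = begin
  (x + 1ℚ) * (x + 1ℚ) ^ᵠ m
    ≡⟨ distrib x ((x + 1ℚ) ^ᵠ m) ⟩
  x * (x + 1ℚ) ^ᵠ m + (x + 1ℚ) ^ᵠ m
    ≡⟨ cong₂ (λ a b → x * a + b) (binomial x m<n) (binomial x (ℕₚ.m<n⇒m<1+n m<n)) ⟩
  x * ∑ n (λ l → m Cℚ l * x ^ᵠ l) + ∑ (suc n) (λ l → m Cℚ l * x ^ᵠ l)
    ≡⟨ cong₂ _+_ (∑-*ˡ n x (λ l → m Cℚ l * x ^ᵠ l)) (∑-shift n (λ l → m Cℚ l * x ^ᵠ l)) ⟩
  ∑ n (λ l → x * (m Cℚ l * x ^ᵠ l)) + (1ℚ * 1ℚ + ∑ n (λ l → m Cℚ suc l * x ^ᵠ suc l))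
    ≡⟨ reassoc (∑ n (λ l → x * (m Cℚ l * x ^ᵠ l))) (1ℚ * 1ℚ) (∑ n (λ l → m Cℚ suc l * x ^ᵠ suc l)) ⟩
  1ℚ * 1ℚ + (∑ n (λ l → x * (m Cℚ l * x ^ᵠ l)) + ∑ n (λ l → m Cℚ suc l * x ^ᵠ suc l))
    ≡⟨ cong (1ℚ * 1ℚ +_) (sym (∑-+ n _ _)) ⟩
  1ℚ * 1ℚ + ∑ n (λ l → x * (m Cℚ l * x ^ᵠ l) + m Cℚ suc l * x ^ᵠ suc l)
    ≡⟨ cong (1ℚ * 1ℚ +_) (∑-cong n (λ l _ → coefficient l)) ⟩
  1ℚ * 1ℚ + ∑ n (λ l → suc m Cℚ suc l * x ^ᵠ suc l)
    ≡⟨ sym (∑-shift n (λ l → suc m Cℚ l * x ^ᵠ l)) ⟩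
  ∑ (suc n) (λ l → suc m Cℚ l * x ^ᵠ l)
    ∎
  where
  distrib : ∀ x u → (x + 1ℚ) * u ≡ x * u + u
  distrib = solve-∀ ℚ-ring
  reassoc : ∀ a b c → a + (b + c) ≡ b + (a + c)
  reassoc = solve-∀ ℚ-ring
  collect : ∀ x a b u → x * (a * u) + b * (x * u) ≡ (a + b) * (x * u)
  collect = solve-∀ ℚ-ring
  -- Pascal's rule merges the coefficients of x^(l+1)
  coefficient : ∀ l → x * (m Cℚ l * x ^ᵠ l) + m Cℚ suc l * x ^ᵠ suc l ≡ suc m Cℚ suc l * x ^ᵠ suc l
  coefficient l = trans (collect x (m Cℚ l) (m Cℚ suc l) (x ^ᵠ l)) (cong (_* x ^ᵠ suc l) (pascal m l))

binomial-step : ∀ m x → (x + 1ℚ) ^ᵠ m ≡ x ^ᵠ m + ∑ m (λ l → m Cℚ l * x ^ᵠ l)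
binomial-step m x = begin
  (x + 1ℚ) ^ᵠ m                                  ≡⟨ binomial x (ℕₚ.n<1+n m) ⟩
  ∑ m (λ l → m Cℚ l * x ^ᵠ l) + m Cℚ m * x ^ᵠ m  ≡⟨ cong (λ c → ∑ m (λ l → m Cℚ l * x ^ᵠ l) + ℕ→ℚ c * x ^ᵠ m) (nCn≡1 m) ⟩
  ∑ m (λ l → m Cℚ l * x ^ᵠ l) + 1ℚ * x ^ᵠ m      ≡⟨ swap (∑ m (λ l → m Cℚ l * x ^ᵠ l)) (x ^ᵠ m) ⟩
  x ^ᵠ m + ∑ m (λ l → m Cℚ l * x ^ᵠ l)           ∎
  where
  swap : ∀ a u → a + 1ℚ * u ≡ u + a
  swap = solve-∀ ℚ-ring

C-factorials : ∀ {n k} → k ℕ.≤ n → (n C k) ℕ.* (k ! ℕ.* (n ∸ k) !) ≡ n !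
C-factorials {n} {k} k≤n = trans
  (cong (ℕ._* (k ! ℕ.* (n ∸ k) !)) (nCk≡n!/k![n-k]! k≤n))
  (m/n*n≡m {{k ℕₚ.!* (n ∸ k) !≢0}} (k![n∸k]!∣n! k≤n))

C-absorption : ∀ {p i} → i ℕ.≤ p → (suc p C i) ℕ.* (suc p ∸ i) ≡ suc p ℕ.* (p C i)
C-absorption {p} {i} i≤p = ℕₚ.*-cancelʳ-≡ _ _ (i ! ℕ.* (p ∸ i) !) {{i ℕₚ.!* (p ∸ i) !≢0}} (begin
  (suc p C i) ℕ.* (suc p ∸ i) ℕ.* (i ! ℕ.* (p ∸ i) !)
    ≡⟨ cong (λ r → (suc p C i) ℕ.* r ℕ.* (i ! ℕ.* (p ∸ i) !)) p+1-i≡ ⟩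
  (suc p C i) ℕ.* suc (p ∸ i) ℕ.* (i ! ℕ.* (p ∸ i) !)
    ≡⟨ regroup (suc p C i) (suc (p ∸ i)) (i !) ((p ∸ i) !) ⟩
  (suc p C i) ℕ.* (i ! ℕ.* suc (p ∸ i) !)
    ≡⟨ cong (λ r → (suc p C i) ℕ.* (i ! ℕ.* r !)) (sym p+1-i≡) ⟩
  (suc p C i) ℕ.* (i ! ℕ.* (suc p ∸ i) !)
    ≡⟨ C-factorials (ℕₚ.m≤n⇒m≤1+n i≤p) ⟩
  suc p !
    ≡⟨ cong (suc p ℕ.*_) (sym (C-factorials i≤p)) ⟩
  suc p ℕ.* ((p C i) ℕ.* (i ! ℕ.* (p ∸ i) !))
    ≡⟨ sym (ℕₚ.*-assoc (suc p) (p C i) _) ⟩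
  suc p ℕ.* (p C i) ℕ.* (i ! ℕ.* (p ∸ i) !)
    ∎)
  where
  p+1-i≡ : suc p ∸ i ≡ suc (p ∸ i)
  p+1-i≡ = ℕₚ.+-∸-assoc 1 i≤p
  regroup : ∀ c s f g → c ℕ.* s ℕ.* (f ℕ.* g) ≡ c ℕ.* (f ℕ.* (s ℕ.* g))
  regroup = solve-∀ ℕ-Solver.ring

-- Trinomial revision: C(n,i) · C(n-i,l) = C(n,l) · C(n-l,i)  for i + l ≤ n;
-- both sides equal n! / (i! l! (n-i-l)!).
C-trinomial : ∀ {n i l} → i ℕ.+ l ℕ.≤ n → (n C i) ℕ.* ((n ∸ i) C l) ≡ (n C l) ℕ.* ((n ∸ l) C i)
C-trinomial {n} {i} {l} i+l≤n = ℕₚ.*-cancelʳ-≡ _ _ (i ! ℕ.* (l ! ℕ.* r !)) {{nonZero}} (begin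
  (n C i) ℕ.* ((n ∸ i) C l) ℕ.* (i ! ℕ.* (l ! ℕ.* r !))
    ≡⟨ regroup (n C i) ((n ∸ i) C l) (i !) (l !) (r !) ⟩
  (n C i) ℕ.* (i ! ℕ.* (((n ∸ i) C l) ℕ.* (l ! ℕ.* r !)))
    ≡⟨ cong (λ z → (n C i) ℕ.* (i ! ℕ.* z)) (C-factorials l≤n-i) ⟩
  (n C i) ℕ.* (i ! ℕ.* (n ∸ i) !)
    ≡⟨ C-factorials i≤n ⟩
  n !
    ≡⟨ sym (C-factorials l≤n) ⟩
  (n C l) ℕ.* (l ! ℕ.* (n ∸ l) !)
    ≡⟨ cong (λ z → (n C l) ℕ.* (l ! ℕ.* z)) (sym (C-factorials i≤n-l)) ⟩
  (n C l) ℕ.* (l ! ℕ.* (((n ∸ l) C i) ℕ.* (i ! ℕ.* ((n ∸ l) ∸ i) !)))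
    ≡⟨ cong (λ z → (n C l) ℕ.* (l ! ℕ.* (((n ∸ l) C i) ℕ.* (i ! ℕ.* z !)))) n-l-i≡r ⟩
  (n C l) ℕ.* (l ! ℕ.* (((n ∸ l) C i) ℕ.* (i ! ℕ.* r !)))
    ≡⟨ sym (regroup′ (n C l) ((n ∸ l) C i) (i !) (l !) (r !)) ⟩
  (n C l) ℕ.* ((n ∸ l) C i) ℕ.* (i ! ℕ.* (l ! ℕ.* r !))
    ∎)
  where
  r = (n ∸ i) ∸ l
  nonZero : ℕ.NonZero (i ! ℕ.* (l ! ℕ.* r !))
  nonZero = ℕₚ.m*n≢0 (i !) _ {{i ℕₚ.!≢0}} {{l ℕₚ.!* r !≢0}}
  i≤n : i ℕ.≤ n
  i≤n = ℕₚ.≤-trans (ℕₚ.m≤m+n i l) i+l≤n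
  l≤n : l ℕ.≤ n
  l≤n = ℕₚ.≤-trans (ℕₚ.m≤n+m l i) i+l≤n
  l≤n-i : l ℕ.≤ n ∸ i
  l≤n-i = ℕₚ.m+n≤o⇒m≤o∸n l (subst (ℕ._≤ n) (ℕₚ.+-comm i l) i+l≤n)
  i≤n-l : i ℕ.≤ n ∸ l
  i≤n-l = ℕₚ.m+n≤o⇒m≤o∸n i i+l≤n
  n-l-i≡r : (n ∸ l) ∸ i ≡ r
  n-l-i≡r = trans (ℕₚ.∸-+-assoc n l i) (trans (cong (n ∸_) (ℕₚ.+-comm l i)) (sym (ℕₚ.∸-+-assoc n i l)))
  regroup : ∀ a b f g h → a ℕ.* b ℕ.* (f ℕ.* (g ℕ.* h)) ≡ a ℕ.* (f ℕ.* (b ℕ.* (g ℕ.* h)))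
  regroup = solve-∀ ℕ-Solver.ring
  regroup′ : ∀ a b f g h → a ℕ.* b ℕ.* (f ℕ.* (g ℕ.* h)) ≡ a ℕ.* (g ℕ.* (b ℕ.* (f ℕ.* h)))
  regroup′ = solve-∀ ℕ-Solver.ring

C-suc-self : ∀ m → suc m C m ≡ suc m
C-suc-self m = trans (nCk≡nC[n∸k] (ℕₚ.n≤1+n m)) (trans (cong (suc m C_) (ℕₚ.m+n∸n≡m 1 m)) (nC1≡n (suc m)))

bernUpTo-stable : ∀ d m → bernUpTo (d ℕ.+ m) m ≡ B m
bernUpTo-stable zero    m = refl
bernUpTo-stable (suc d) m rewrite ≤ᵇ-true (ℕₚ.m≤n+m m d) = bernUpTo-stable d m

bernUpTo≡B : ∀ {n m} → m ℕ.≤ n → bernUpTo n m ≡ B m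
bernUpTo≡B {n} {m} m≤n = trans (cong (λ r → bernUpTo r m) (sym (ℕₚ.m∸n+n≡m m≤n))) (bernUpTo-stable (n ∸ m) m)

B-recurrence : ∀ n → B (suc n) ≡ - ((⁺ 1) / suc (suc n)) * ∑ (suc n) (λ l → suc (suc n) Cℚ l * B l)
B-recurrence n rewrite ≤ᵇ-false (ℕₚ.n≮n n) =
  cong (- ((⁺ 1) / suc (suc n)) *_)
       (∑-cong (suc n) (λ l l≤n → cong (suc (suc n) Cℚ l *_) (bernUpTo≡B (ℕₚ.≤-pred l≤n))))

B-sum : ∀ n → ∑ (suc (suc n)) (λ l → suc (suc n) Cℚ l * B l) ≡ 0ℚ
B-sum n = begin
  S + suc (suc n) Cℚ suc n * B (suc n)
    ≡⟨ cong₂ (λ c b → S + ℕ→ℚ c * b) (C-suc-self (suc n)) (B-recurrence n) ⟩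
  S + ℕ→ℚ (suc (suc n)) * (- v * S)
    ≡⟨ rearrange S (ℕ→ℚ (suc (suc n))) v ⟩
  S - (v * ℕ→ℚ (suc (suc n))) * S
    ≡⟨ cong (λ u → S - u * S) (*-inverse-suc (suc n)) ⟩
  S - 1ℚ * S
    ≡⟨ cancel S ⟩
  0ℚ ∎
  where
  v = (⁺ 1) / suc (suc n)
  S = ∑ (suc n) (λ l → suc (suc n) Cℚ l * B l)
  rearrange : ∀ s a v → s + a * (- v * s) ≡ s - (v * a) * s
  rearrange = solve-∀ ℚ-ring
  cancel : ∀ s → s - 1ℚ * s ≡ 0ℚ
  cancel = solve-∀ ℚ-ring

-- F p x = ∑_{i ≤ p} C(p+1,i) B_i x^(p+1-i), i.e. B_{p+1}(x) - B_{p+1} for the Bernoulli polynomial B_{p+1}.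
F : ℕ → ℚ → ℚ
F p x = ∑ (suc p) (λ i → suc p Cℚ i * B i * x ^ᵠ (suc p ∸ i))

-- The inner Bernoulli sums that appear in F p (x + 1) - F p x:
-- ∑_{i < p+1-l} C(p+1-l, i) B_i vanishes for l < p (and is B_0 = 1 for l = p).
B-column : ∀ p l → l ℕ.< p → ∑ (suc p ∸ l) (λ i → (suc p ∸ l) Cℚ i * B i) ≡ 0ℚ
B-column p l l<p = trans (cong (λ r → ∑ r (λ i → r Cℚ i * B i)) p+1-l≡) (B-sum (p ∸ suc l))
  where
  p+1-l≡ : suc p ∸ l ≡ suc (suc (p ∸ suc l))
  p+1-l≡ = trans (ℕₚ.+-∸-assoc 1 (ℕₚ.<⇒≤ l<p)) (cong suc (ℕₚ.+-∸-assoc 1 l<p))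

triangle-bound : ∀ {n i l} → i ℕ.< n → l ℕ.< n ∸ i → i ℕ.+ l ℕ.≤ n
triangle-bound {n} {i} {l} i<n l<n-i =
  subst (ℕ._≤ n) (ℕₚ.+-comm l i) (ℕₚ.m≤o∸n⇒m+n≤o l (ℕₚ.<⇒≤ i<n) (ℕₚ.<⇒≤ l<n-i))

-- The binomial expansion of F p (x + 1) - F p x, after exchanging the two sums,
-- collapses by B-column to the single term (p+1) x^p.
F-increment : ∀ p x →
  triangle (suc p) (λ i l → suc p Cℚ i * B i * ((suc p ∸ i) Cℚ l * x ^ᵠ l)) ≡ ℕ→ℚ (suc p) * x ^ᵠ p
F-increment p x = begin
  triangle P (λ i l → P Cℚ i * B i * ((P ∸ i) Cℚ l * x ^ᵠ l))
    ≡⟨ ∑-cong P (λ i i<P → ∑-cong (P ∸ i) (λ l l<P-i → revise i l (triangle-bound i<P l<P-i))) ⟩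
  triangle P (λ i l → x ^ᵠ l * P Cℚ l * ((P ∸ l) Cℚ i * B i))
    ≡⟨ triangle-transpose P (λ i l → x ^ᵠ l * P Cℚ l * ((P ∸ l) Cℚ i * B i)) ⟩
  ∑ P (λ l → ∑ (P ∸ l) (λ i → x ^ᵠ l * P Cℚ l * ((P ∸ l) Cℚ i * B i)))
    ≡⟨ ∑-cong P (λ l _ → sym (∑-*ˡ (P ∸ l) (x ^ᵠ l * P Cℚ l) (λ i → (P ∸ l) Cℚ i * B i))) ⟩
  ∑ p column + column p
    ≡⟨ cong (_+ column p) (∑-zero p (λ l l<p → trans (cong (x ^ᵠ l * P Cℚ l *_) (B-column p l l<p)) (ℚₚ.*-zeroʳ (x ^ᵠ l * P Cℚ l)))) ⟩
  0ℚ + x ^ᵠ p * P Cℚ p * ∑ (P ∸ p) (λ i → (P ∸ p) Cℚ i * B i)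
    ≡⟨ cong (λ r → 0ℚ + x ^ᵠ p * P Cℚ p * ∑ r (λ i → r Cℚ i * B i)) (ℕₚ.m+n∸n≡m 1 p) ⟩
  0ℚ + x ^ᵠ p * P Cℚ p * 1ℚ
    ≡⟨ cong (λ c → 0ℚ + x ^ᵠ p * ℕ→ℚ c * 1ℚ) (C-suc-self p) ⟩
  0ℚ + x ^ᵠ p * ℕ→ℚ P * 1ℚ
    ≡⟨ tidy (x ^ᵠ p) (ℕ→ℚ P) ⟩
  ℕ→ℚ P * x ^ᵠ p
    ∎
  where
  P = suc p
  column : ℕ → ℚ
  column l = x ^ᵠ l * P Cℚ l * ∑ (P ∸ l) (λ i → (P ∸ l) Cℚ i * B i)
  regroup : ∀ a b c u → a * b * (c * u) ≡ u * (a * c) * b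
  regroup = solve-∀ ℚ-ring
  regroup′ : ∀ a b c u → u * (a * c) * b ≡ u * a * (c * b)
  regroup′ = solve-∀ ℚ-ring
  tidy : ∀ u a → 0ℚ + u * a * 1ℚ ≡ a * u
  tidy = solve-∀ ℚ-ring
  revise : ∀ i l → i ℕ.+ l ℕ.≤ P →
    P Cℚ i * B i * ((P ∸ i) Cℚ l * x ^ᵠ l) ≡ x ^ᵠ l * P Cℚ l * ((P ∸ l) Cℚ i * B i)
  revise i l i+l≤P = begin
    P Cℚ i * B i * ((P ∸ i) Cℚ l * x ^ᵠ l)  ≡⟨ regroup (P Cℚ i) (B i) ((P ∸ i) Cℚ l) (x ^ᵠ l) ⟩
    x ^ᵠ l * (P Cℚ i * (P ∸ i) Cℚ l) * B i  ≡⟨ cong (λ c → x ^ᵠ l * c * B i) coefficients ⟩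
    x ^ᵠ l * (P Cℚ l * (P ∸ l) Cℚ i) * B i  ≡⟨ regroup′ (P Cℚ l) (B i) ((P ∸ l) Cℚ i) (x ^ᵠ l) ⟩
    x ^ᵠ l * P Cℚ l * ((P ∸ l) Cℚ i * B i)  ∎
    where
    coefficients : P Cℚ i * (P ∸ i) Cℚ l ≡ P Cℚ l * (P ∸ l) Cℚ i
    coefficients = begin
      P Cℚ i * (P ∸ i) Cℚ l            ≡⟨ sym (ℕ→ℚ-* (P C i) ((P ∸ i) C l)) ⟩
      ℕ→ℚ ((P C i) ℕ.* ((P ∸ i) C l))  ≡⟨ cong ℕ→ℚ (C-trinomial {P} {i} {l} i+l≤P) ⟩
      ℕ→ℚ ((P C l) ℕ.* ((P ∸ l) C i))  ≡⟨ ℕ→ℚ-* (P C l) ((P ∸ l) C i) ⟩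
      P Cℚ l * (P ∸ l) Cℚ i            ∎

F-step : ∀ p x → F p (x + 1ℚ) ≡ F p x + ℕ→ℚ (suc p) * x ^ᵠ p
F-step p x = begin
  ∑ P (λ i → c i * (x + 1ℚ) ^ᵠ (P ∸ i))
    ≡⟨ ∑-cong P (λ i _ → cong (c i *_) (binomial-step (P ∸ i) x)) ⟩
  ∑ P (λ i → c i * (x ^ᵠ (P ∸ i) + ∑ (P ∸ i) (λ l → (P ∸ i) Cℚ l * x ^ᵠ l)))
    ≡⟨ ∑-cong P (λ i _ → ℚₚ.*-distribˡ-+ (c i) _ _) ⟩
  ∑ P (λ i → c i * x ^ᵠ (P ∸ i) + c i * ∑ (P ∸ i) (λ l → (P ∸ i) Cℚ l * x ^ᵠ l))
    ≡⟨ ∑-+ P _ _ ⟩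
  F p x + ∑ P (λ i → c i * ∑ (P ∸ i) (λ l → (P ∸ i) Cℚ l * x ^ᵠ l))
    ≡⟨ cong (F p x +_) (∑-cong P (λ i _ → ∑-*ˡ (P ∸ i) (c i) (λ l → (P ∸ i) Cℚ l * x ^ᵠ l))) ⟩
  F p x + triangle P (λ i l → c i * ((P ∸ i) Cℚ l * x ^ᵠ l))
    ≡⟨ cong (F p x +_) (F-increment p x) ⟩
  F p x + ℕ→ℚ P * x ^ᵠ p
    ∎
  where
  P = suc p
  c : ℕ → ℚ
  c i = P Cℚ i * B i

0^[p+1-i]≡0 : ∀ p i → i ℕ.< suc p → 0ℚ ^ᵠ (suc p ∸ i) ≡ 0ℚ
0^[p+1-i]≡0 p i i≤p rewrite ℕₚ.+-∸-assoc 1 (ℕₚ.≤-pred i≤p) = ℚₚ.*-zeroˡ (0ℚ ^ᵠ (p ∸ i))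

F-zero : ∀ p → F p 0ℚ ≡ 0ℚ
F-zero p = ∑-zero (suc p) (λ i i≤p →
  trans (cong (suc p Cℚ i * B i *_) (0^[p+1-i]≡0 p i i≤p)) (ℚₚ.*-zeroʳ (suc p Cℚ i * B i)))

faulhaber : ∀ p n → F p (ℕ→ℚ n) ≡ ℕ→ℚ (suc p) * ∑ n (λ t → ℕ→ℚ t ^ᵠ p)
faulhaber p n = trans
  (telescope (λ m → F p (ℕ→ℚ m)) (λ t → ℕ→ℚ (suc p) * ℕ→ℚ t ^ᵠ p) (F-zero p)
             (λ m → trans (cong (F p) (ℕ→ℚ-suc m)) (F-step p (ℕ→ℚ m))) n)
  (sym (∑-*ˡ n (ℕ→ℚ (suc p)) (λ t → ℕ→ℚ t ^ᵠ p)))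

-- G p x = ∑_{i ≤ p} C(p+1,i) (-1)^i B_i x^(p+1-i): F with the sign of B_1 flipped.
G : ℕ → ℚ → ℚ
G p x = ∑ (suc p) (λ i → suc p Cℚ i * sgn i * B i * x ^ᵠ (suc p ∸ i))

G-reflect : ∀ p x → G p x ≡ sgn (suc p) * F p (- x)
G-reflect p x = trans
  (∑-cong P (λ i i<P → summand i (ℕₚ.<⇒≤ i<P)))
  (sym (∑-*ˡ P (sgn P) (λ i → P Cℚ i * B i * (- x) ^ᵠ (P ∸ i))))
  where
  P = suc p
  regroup : ∀ c s t b u → c * (s * t) * b * u ≡ s * (c * b * (t * u))
  regroup = solve-∀ ℚ-ring
  summand : ∀ i → i ℕ.≤ P →
    P Cℚ i * sgn i * B i * x ^ᵠ (P ∸ i) ≡ sgn P * (P Cℚ i * B i * (- x) ^ᵠ (P ∸ i))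
  summand i i≤P = begin
    P Cℚ i * sgn i * B i * x ^ᵠ (P ∸ i)
      ≡⟨ cong (λ s → P Cℚ i * s * B i * x ^ᵠ (P ∸ i)) (sym (sgn-∸ i≤P)) ⟩
    P Cℚ i * (sgn P * sgn (P ∸ i)) * B i * x ^ᵠ (P ∸ i)
      ≡⟨ regroup (P Cℚ i) (sgn P) (sgn (P ∸ i)) (B i) (x ^ᵠ (P ∸ i)) ⟩
    sgn P * (P Cℚ i * B i * (sgn (P ∸ i) * x ^ᵠ (P ∸ i)))
      ≡⟨ cong (λ u → sgn P * (P Cℚ i * B i * u)) (sym (neg-^ x (P ∸ i))) ⟩
    sgn P * (P Cℚ i * B i * (- x) ^ᵠ (P ∸ i))
      ∎

-- Reflecting F-step: G is a discrete antiderivative of (p+1) (x+1)^p.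
G-step : ∀ p x → G p (x + 1ℚ) ≡ G p x + ℕ→ℚ (suc p) * (x + 1ℚ) ^ᵠ p
G-step p x = begin
  G p (x + 1ℚ)
    ≡⟨ G-reflect p (x + 1ℚ) ⟩
  - σ * F p y
    ≡⟨ shuffle σ (F p y) (ℕ→ℚ (suc p)) u ⟩
  - σ * (F p y + ℕ→ℚ (suc p) * (σ * u)) + σ * σ * (ℕ→ℚ (suc p) * u)
    ≡⟨ cong₂ (λ a s → - σ * a + s * (ℕ→ℚ (suc p) * u)) (sym F[-x]) (sgn-square p) ⟩
  - σ * F p (- x) + 1ℚ * (ℕ→ℚ (suc p) * u)
    ≡⟨ cong₂ _+_ (sym (G-reflect p x)) (ℚₚ.*-identityˡ _) ⟩
  G p x + ℕ→ℚ (suc p) * u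
    ∎
  where
  σ = sgn p
  y = - (x + 1ℚ)
  u = (x + 1ℚ) ^ᵠ p
  shuffle : ∀ s f a u → - s * f ≡ - s * (f + a * (s * u)) + s * s * (a * u)
  shuffle = solve-∀ ℚ-ring
  -x≡y+1 : ∀ x → - x ≡ - (x + 1ℚ) + 1ℚ
  -x≡y+1 = solve-∀ ℚ-ring
  F[-x] : F p (- x) ≡ F p y + ℕ→ℚ (suc p) * (σ * u)
  F[-x] = begin
    F p (- x)                           ≡⟨ cong (F p) (-x≡y+1 x) ⟩
    F p (y + 1ℚ)                        ≡⟨ F-step p y ⟩
    F p y + ℕ→ℚ (suc p) * y ^ᵠ p        ≡⟨ cong (λ v → F p y + ℕ→ℚ (suc p) * v) (neg-^ (x + 1ℚ) p) ⟩
    F p y + ℕ→ℚ (suc p) * (σ * u)       ∎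

G-zero : ∀ p → G p 0ℚ ≡ 0ℚ
G-zero p = ∑-zero (suc p) (λ i i≤p →
  trans (cong (suc p Cℚ i * sgn i * B i *_) (0^[p+1-i]≡0 p i i≤p)) (ℚₚ.*-zeroʳ (suc p Cℚ i * sgn i * B i)))

faulhaber⁺ : ∀ p n → G p (ℕ→ℚ n) ≡ ℕ→ℚ (suc p) * ∑ n (λ t → ℕ→ℚ (suc t) ^ᵠ p)
faulhaber⁺ p n = trans
  (telescope (λ m → G p (ℕ→ℚ m)) (λ t → ℕ→ℚ (suc p) * ℕ→ℚ (suc t) ^ᵠ p) (G-zero p) step n)
  (sym (∑-*ˡ n (ℕ→ℚ (suc p)) (λ t → ℕ→ℚ (suc t) ^ᵠ p)))
  where
  step : ∀ m → G p (ℕ→ℚ (suc m)) ≡ G p (ℕ→ℚ m) + ℕ→ℚ (suc p) * ℕ→ℚ (suc m) ^ᵠ p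
  step m rewrite ℕ→ℚ-suc m = G-step p (ℕ→ℚ m)

-- The summand of RHS K p₁ p₂ at (i, j), verbatim from Defs; RHS K p₁ p₂ is by definition
-- ∑_{i,j ≤ p₁+p₂} term K p₁ p₂ i j.
term : ℕ → ℕ → ℕ → ℕ → ℕ → ℚ
term K p₁ p₂ i j =
  if (p₁ ≤ᵇ i ℕ.+ j) ∧ (i ℕ.+ j ≤ᵇ p₁ ℕ.+ p₂)
  then sgn (j ℕ.+ p₁) * ℕ→ℚ ((i ℕ.+ j) C i) * ℕ→ℚ (p₂ C (i ℕ.+ j ∸ p₁))
       * (B i * ((⁺ 1) / suc j))
       * (ℕ→ℚ (K ∸ 1)) ^ᵠ (suc j) * (ℕ→ℚ K) ^ᵠ (p₁ ℕ.+ p₂ ∸ (i ℕ.+ j))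
  else 0ℚ

term-inside : ∀ K p₁ p₂ i j → p₁ ℕ.≤ i ℕ.+ j → i ℕ.+ j ℕ.≤ p₁ ℕ.+ p₂ →
  term K p₁ p₂ i j ≡ sgn (j ℕ.+ p₁) * ℕ→ℚ ((i ℕ.+ j) C i) * ℕ→ℚ (p₂ C (i ℕ.+ j ∸ p₁))
                     * (B i * ((⁺ 1) / suc j))
                     * (ℕ→ℚ (K ∸ 1)) ^ᵠ (suc j) * (ℕ→ℚ K) ^ᵠ (p₁ ℕ.+ p₂ ∸ (i ℕ.+ j))
term-inside K p₁ p₂ i j p₁≤s s≤p = if-cong (cong₂ _∧_ (≤ᵇ-true p₁≤s) (≤ᵇ-true s≤p))

term-below : ∀ K p₁ p₂ i j → i ℕ.+ j ℕ.< p₁ → term K p₁ p₂ i j ≡ 0ℚ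
term-below K p₁ p₂ i j s<p₁ = if-cong (cong (_∧ (i ℕ.+ j ≤ᵇ p₁ ℕ.+ p₂)) (≤ᵇ-false (ℕₚ.<⇒≱ s<p₁)))

term-above : ∀ K p₁ p₂ i j → p₁ ℕ.+ p₂ ℕ.< i ℕ.+ j → term K p₁ p₂ i j ≡ 0ℚ
term-above K p₁ p₂ i j p<s =
  if-cong (trans (cong ((p₁ ≤ᵇ i ℕ.+ j) ∧_) (≤ᵇ-false (ℕₚ.<⇒≱ p<s))) (∧-zeroʳ (p₁ ≤ᵇ i ℕ.+ j)))

-- term factors as weight K i j * window K p₁ p₂ (i + j): weight depends on (i, j) only, window on
-- p₁, p₂ and s = i + j only.  All p₂-dependence sits in the binomial pattern C(n,e) K^(n-e).
weight : ℕ → ℕ → ℕ → ℚ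
weight K i j = sgn j * (i ℕ.+ j) Cℚ i * (B i * ((⁺ 1) / suc j)) * ℕ→ℚ (K ∸ 1) ^ᵠ suc j

binomialPattern : ℕ → ℕ → ℕ → ℚ
binomialPattern K n e = n Cℚ e * ℕ→ℚ K ^ᵠ (n ∸ e)

-- (The upper constraint s ≤ p₁ + p₂ of RHS needs no test here: C(p₂, s - p₁) vanishes beyond it.)
window : ℕ → ℕ → ℕ → ℕ → ℚ
window K p₁ p₂ s = if p₁ ≤ᵇ s then sgn p₁ * binomialPattern K p₂ (s ∸ p₁) else 0ℚ

window-inside : ∀ K p₁ p₂ s → p₁ ℕ.≤ s → window K p₁ p₂ s ≡ sgn p₁ * binomialPattern K p₂ (s ∸ p₁)
window-inside K p₁ p₂ s p₁≤s = if-cong (≤ᵇ-true p₁≤s)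

window-below : ∀ K p₁ p₂ s → s ℕ.< p₁ → window K p₁ p₂ s ≡ 0ℚ
window-below K p₁ p₂ s s<p₁ = if-cong (≤ᵇ-false (ℕₚ.<⇒≱ s<p₁))

-- The factorisation, in the three ranges of s = i + j: below p₁ and above p₁ + p₂ both sides
-- vanish (above, because C(p₂, s - p₁) = 0); inside, (-1)^(j+p₁) = (-1)^j (-1)^p₁ and
-- K^(p₁+p₂-s) = K^(p₂-(s-p₁)).
factor-below : ∀ K p₁ p₂ i j → i ℕ.+ j ℕ.< p₁ →
  term K p₁ p₂ i j ≡ weight K i j * window K p₁ p₂ (i ℕ.+ j)
factor-below K p₁ p₂ i j s<p₁ = trans
  (term-below K p₁ p₂ i j s<p₁)
  (sym (trans (cong (weight K i j *_) (window-below K p₁ p₂ (i ℕ.+ j) s<p₁)) (ℚₚ.*-zeroʳ (weight K i j))))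

factor-inside : ∀ K p₁ p₂ i j → p₁ ℕ.≤ i ℕ.+ j → i ℕ.+ j ℕ.≤ p₁ ℕ.+ p₂ →
  term K p₁ p₂ i j ≡ weight K i j * window K p₁ p₂ (i ℕ.+ j)
factor-inside K p₁ p₂ i j p₁≤s s≤p = begin
  term K p₁ p₂ i j
    ≡⟨ term-inside K p₁ p₂ i j p₁≤s s≤p ⟩
  sgn (j ℕ.+ p₁) * X * Y * R * W * ℕ→ℚ K ^ᵠ (p₁ ℕ.+ p₂ ∸ s)
    ≡⟨ cong₂ (λ σ k → σ * X * Y * R * W * ℕ→ℚ K ^ᵠ k) (sgn-+ j p₁) exponent ⟩
  sgn j * sgn p₁ * X * Y * R * W * ℕ→ℚ K ^ᵠ (p₂ ∸ (s ∸ p₁))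
    ≡⟨ regroup (sgn j) (sgn p₁) X Y R W (ℕ→ℚ K ^ᵠ (p₂ ∸ (s ∸ p₁))) ⟩
  weight K i j * (sgn p₁ * binomialPattern K p₂ (s ∸ p₁))
    ≡⟨ cong (weight K i j *_) (sym (window-inside K p₁ p₂ s p₁≤s)) ⟩
  weight K i j * window K p₁ p₂ s
    ∎
  where
  s = i ℕ.+ j
  X = s Cℚ i
  Y = p₂ Cℚ (s ∸ p₁)
  R = B i * ((⁺ 1) / suc j)
  W = ℕ→ℚ (K ∸ 1) ^ᵠ suc j
  exponent : p₁ ℕ.+ p₂ ∸ s ≡ p₂ ∸ (s ∸ p₁)
  exponent = trans (cong (p₁ ℕ.+ p₂ ∸_) (sym (ℕₚ.m+[n∸m]≡n p₁≤s))) (ℕₚ.[m+n]∸[m+o]≡n∸o p₁ p₂ (s ∸ p₁))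
  regroup : ∀ a b x y r w e → a * b * x * y * r * w * e ≡ a * x * r * w * (b * (y * e))
  regroup = solve-∀ ℚ-ring

factor-above : ∀ K p₁ p₂ i j → p₁ ℕ.≤ i ℕ.+ j → p₁ ℕ.+ p₂ ℕ.< i ℕ.+ j →
  term K p₁ p₂ i j ≡ weight K i j * window K p₁ p₂ (i ℕ.+ j)
factor-above K p₁ p₂ i j p₁≤s p<s = trans
  (term-above K p₁ p₂ i j p<s)
  (sym (begin
    weight K i j * window K p₁ p₂ s
      ≡⟨ cong (weight K i j *_) (window-inside K p₁ p₂ s p₁≤s) ⟩
    weight K i j * (sgn p₁ * (ℕ→ℚ (p₂ C (s ∸ p₁)) * ℕ→ℚ K ^ᵠ (p₂ ∸ (s ∸ p₁))))
      ≡⟨ cong (λ c → weight K i j * (sgn p₁ * (ℕ→ℚ c * ℕ→ℚ K ^ᵠ (p₂ ∸ (s ∸ p₁))))) (k>n⇒nCk≡0 p₂<s-p₁) ⟩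
    weight K i j * (sgn p₁ * (0ℚ * ℕ→ℚ K ^ᵠ (p₂ ∸ (s ∸ p₁))))
      ≡⟨ vanish (weight K i j) (sgn p₁) (ℕ→ℚ K ^ᵠ (p₂ ∸ (s ∸ p₁))) ⟩
    0ℚ ∎))
  where
  s = i ℕ.+ j
  p₂<s-p₁ : p₂ ℕ.< s ∸ p₁
  p₂<s-p₁ = ℕₚ.m+n≤o⇒m≤o∸n (suc p₂) (subst (ℕ._≤ s) (cong suc (ℕₚ.+-comm p₁ p₂)) p<s)
  vanish : ∀ w σ u → w * (σ * (0ℚ * u)) ≡ 0ℚ
  vanish = solve-∀ ℚ-ring

term-factorisation : ∀ K p₁ p₂ i j → term K p₁ p₂ i j ≡ weight K i j * window K p₁ p₂ (i ℕ.+ j)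
term-factorisation K p₁ p₂ i j = by-cases (p₁ ℕ.≤? i ℕ.+ j) (i ℕ.+ j ℕ.≤? p₁ ℕ.+ p₂)
  where
  by-cases : Dec (p₁ ℕ.≤ i ℕ.+ j) → Dec (i ℕ.+ j ℕ.≤ p₁ ℕ.+ p₂) →
    term K p₁ p₂ i j ≡ weight K i j * window K p₁ p₂ (i ℕ.+ j)
  by-cases (no p₁≰s)  _         = factor-below K p₁ p₂ i j (ℕₚ.≰⇒> p₁≰s)
  by-cases (yes p₁≤s) (yes s≤p) = factor-inside K p₁ p₂ i j p₁≤s s≤p
  by-cases (yes p₁≤s) (no s≰p)  = factor-above K p₁ p₂ i j p₁≤s (ℕₚ.≰⇒> s≰p)

binomialPattern-suc : ∀ K n e →
  binomialPattern K (suc n) (suc e) ≡ ℕ→ℚ K * binomialPattern K n (suc e) + binomialPattern K n e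
binomialPattern-suc K n e = begin
  suc n Cℚ suc e * k ^ᵠ (n ∸ e)                       ≡⟨ cong (_* k ^ᵠ (n ∸ e)) (sym (pascal n e)) ⟩
  (n Cℚ e + n Cℚ suc e) * k ^ᵠ (n ∸ e)                ≡⟨ distrib (n Cℚ e) (n Cℚ suc e) (k ^ᵠ (n ∸ e)) ⟩
  n Cℚ suc e * k ^ᵠ (n ∸ e) + binomialPattern K n e   ≡⟨ cong (_+ binomialPattern K n e) (raise (e ℕ.<? n)) ⟩
  k * binomialPattern K n (suc e) + binomialPattern K n e ∎
  where
  k = ℕ→ℚ K
  distrib : ∀ a c u → (a + c) * u ≡ c * u + a * u
  distrib = solve-∀ ℚ-ring
  shift : ∀ k c u → c * (k * u) ≡ k * (c * u)
  shift = solve-∀ ℚ-ring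
  raise : Dec (e ℕ.< n) → n Cℚ suc e * k ^ᵠ (n ∸ e) ≡ k * binomialPattern K n (suc e)
  raise (yes e<n) = trans (cong (λ m → n Cℚ suc e * k ^ᵠ m) (ℕₚ.+-∸-assoc 1 e<n))
                          (shift k (n Cℚ suc e) (k ^ᵠ (n ∸ suc e)))
  raise (no e≮n) = begin
    ℕ→ℚ (n C suc e) * k ^ᵠ (n ∸ e)          ≡⟨ cong (λ c → ℕ→ℚ c * k ^ᵠ (n ∸ e)) C≡0 ⟩
    0ℚ * k ^ᵠ (n ∸ e)                        ≡⟨ ℚₚ.*-zeroˡ (k ^ᵠ (n ∸ e)) ⟩
    0ℚ                                       ≡⟨ sym (ℚₚ.*-zeroʳ k) ⟩
    k * 0ℚ                                   ≡⟨ cong (k *_) (sym (ℚₚ.*-zeroˡ (k ^ᵠ (n ∸ suc e)))) ⟩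
    k * (0ℚ * k ^ᵠ (n ∸ suc e))              ≡⟨ cong (λ c → k * (ℕ→ℚ c * k ^ᵠ (n ∸ suc e))) (sym C≡0) ⟩
    k * (ℕ→ℚ (n C suc e) * k ^ᵠ (n ∸ suc e)) ∎
    where
    C≡0 : n C suc e ≡ 0
    C≡0 = k>n⇒nCk≡0 (s≤s (ℕₚ.≮⇒≥ e≮n))

binomialPattern-zero : ∀ K n → binomialPattern K (suc n) 0 ≡ ℕ→ℚ K * binomialPattern K n 0
binomialPattern-zero K n = shift (ℕ→ℚ K) (ℕ→ℚ K ^ᵠ n)
  where
  shift : ∀ k u → 1ℚ * (k * u) ≡ k * (1ℚ * u)
  shift = solve-∀ ℚ-ring

window-below-recurrence : ∀ K p₁ p₂ s → s ℕ.< p₁ →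
  window K p₁ (suc p₂) s ≡ ℕ→ℚ K * window K p₁ p₂ s - window K (suc p₁) p₂ s
window-below-recurrence K p₁ p₂ s s<p₁ = begin
  window K p₁ (suc p₂) s                                ≡⟨ window-below K p₁ (suc p₂) s s<p₁ ⟩
  0ℚ                                                    ≡⟨ zeros (ℕ→ℚ K) ⟩
  ℕ→ℚ K * 0ℚ - 0ℚ                                       ≡⟨ sym (cong₂ (λ a b → ℕ→ℚ K * a - b)
                                                              (window-below K p₁ p₂ s s<p₁)
                                                              (window-below K (suc p₁) p₂ s (ℕₚ.m<n⇒m<1+n s<p₁))) ⟩
  ℕ→ℚ K * window K p₁ p₂ s - window K (suc p₁) p₂ s     ∎
  where
  zeros : ∀ k → 0ℚ ≡ k * 0ℚ - 0ℚ
  zeros = solve-∀ ℚ-ring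

window-diagonal-recurrence : ∀ K p₁ p₂ →
  window K p₁ (suc p₂) p₁ ≡ ℕ→ℚ K * window K p₁ p₂ p₁ - window K (suc p₁) p₂ p₁
window-diagonal-recurrence K p₁ p₂ = begin
  window K p₁ (suc p₂) p₁                         ≡⟨ window-inside K p₁ (suc p₂) p₁ ℕₚ.≤-refl ⟩
  sgn p₁ * binomialPattern K (suc p₂) (p₁ ∸ p₁)   ≡⟨ cong (λ e → sgn p₁ * binomialPattern K (suc p₂) e) (ℕₚ.n∸n≡0 p₁) ⟩
  sgn p₁ * binomialPattern K (suc p₂) 0           ≡⟨ cong (sgn p₁ *_) (binomialPattern-zero K p₂) ⟩
  sgn p₁ * (ℕ→ℚ K * binomialPattern K p₂ 0)       ≡⟨ shift (sgn p₁) (ℕ→ℚ K) (binomialPattern K p₂ 0) ⟩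
  ℕ→ℚ K * (sgn p₁ * binomialPattern K p₂ 0) - 0ℚ  ≡⟨ sym (cong₂ (λ a b → ℕ→ℚ K * (sgn p₁ * binomialPattern K p₂ a) - b)
                                                         (ℕₚ.n∸n≡0 p₁) (window-below K (suc p₁) p₂ p₁ ℕₚ.≤-refl)) ⟩
  ℕ→ℚ K * (sgn p₁ * binomialPattern K p₂ (p₁ ∸ p₁)) - window K (suc p₁) p₂ p₁
                                                  ≡⟨ cong (λ w → ℕ→ℚ K * w - window K (suc p₁) p₂ p₁)
                                                          (sym (window-inside K p₁ p₂ p₁ ℕₚ.≤-refl)) ⟩
  ℕ→ℚ K * window K p₁ p₂ p₁ - window K (suc p₁) p₂ p₁ ∎
  where
  shift : ∀ σ k u → σ * (k * u) ≡ k * (σ * u) - 0ℚ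
  shift = solve-∀ ℚ-ring

window-above-recurrence : ∀ K p₁ p₂ s → p₁ ℕ.< s →
  window K p₁ (suc p₂) s ≡ ℕ→ℚ K * window K p₁ p₂ s - window K (suc p₁) p₂ s
window-above-recurrence K p₁ p₂ s p₁<s = begin
  window K p₁ (suc p₂) s
    ≡⟨ window-inside K p₁ (suc p₂) s p₁≤s ⟩
  sgn p₁ * binomialPattern K (suc p₂) (s ∸ p₁)
    ≡⟨ cong (λ e → sgn p₁ * binomialPattern K (suc p₂) e) s-p₁≡ ⟩
  sgn p₁ * binomialPattern K (suc p₂) (suc e)
    ≡⟨ cong (sgn p₁ *_) (binomialPattern-suc K p₂ e) ⟩
  sgn p₁ * (ℕ→ℚ K * binomialPattern K p₂ (suc e) + binomialPattern K p₂ e)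
    ≡⟨ expand (sgn p₁) (ℕ→ℚ K) (binomialPattern K p₂ (suc e)) (binomialPattern K p₂ e) ⟩
  ℕ→ℚ K * (sgn p₁ * binomialPattern K p₂ (suc e)) - sgn (suc p₁) * binomialPattern K p₂ e
    ≡⟨ sym (cong₂ (λ a b → ℕ→ℚ K * (sgn p₁ * binomialPattern K p₂ a) - b)
                  s-p₁≡ (window-inside K (suc p₁) p₂ s p₁<s)) ⟩
  ℕ→ℚ K * (sgn p₁ * binomialPattern K p₂ (s ∸ p₁)) - window K (suc p₁) p₂ s
    ≡⟨ cong (λ w → ℕ→ℚ K * w - window K (suc p₁) p₂ s) (sym (window-inside K p₁ p₂ s p₁≤s)) ⟩
  ℕ→ℚ K * window K p₁ p₂ s - window K (suc p₁) p₂ s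
    ∎
  where
  e = s ∸ suc p₁
  p₁≤s = ℕₚ.<⇒≤ p₁<s
  s-p₁≡ : s ∸ p₁ ≡ suc e
  s-p₁≡ = ℕₚ.+-∸-assoc 1 p₁<s
  expand : ∀ σ k a b → σ * (k * a + b) ≡ k * (σ * a) - (- σ) * b
  expand = solve-∀ ℚ-ring

window-recurrence : ∀ K p₁ p₂ s →
  window K p₁ (suc p₂) s ≡ ℕ→ℚ K * window K p₁ p₂ s - window K (suc p₁) p₂ s
window-recurrence K p₁ p₂ s with ℕ.<-cmp s p₁
... | tri< s<p₁ _ _ = window-below-recurrence K p₁ p₂ s s<p₁
... | tri≈ _ refl _ = window-diagonal-recurrence K s p₂
... | tri> _ _ p₁<s = window-above-recurrence K p₁ p₂ s p₁<s

-- Hence each summand of RHS satisfies the recurrence  t(p₁, p₂+1) = K t(p₁, p₂) - t(p₁+1, p₂) ...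
term-recurrence : ∀ K p₁ p₂ i j →
  term K p₁ (suc p₂) i j ≡ ℕ→ℚ K * term K p₁ p₂ i j - term K (suc p₁) p₂ i j
term-recurrence K p₁ p₂ i j = begin
  term K p₁ (suc p₂) i j                           ≡⟨ term-factorisation K p₁ (suc p₂) i j ⟩
  w * window K p₁ (suc p₂) s                       ≡⟨ cong (w *_) (window-recurrence K p₁ p₂ s) ⟩
  w * (ℕ→ℚ K * window K p₁ p₂ s - window K (suc p₁) p₂ s)
                                                   ≡⟨ distrib w (ℕ→ℚ K) (window K p₁ p₂ s) (window K (suc p₁) p₂ s) ⟩
  ℕ→ℚ K * (w * window K p₁ p₂ s) - w * window K (suc p₁) p₂ s
                                                   ≡⟨ sym (cong₂ (λ a b → ℕ→ℚ K * a - b)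
                                                             (term-factorisation K p₁ p₂ i j)
                                                             (term-factorisation K (suc p₁) p₂ i j)) ⟩
  ℕ→ℚ K * term K p₁ p₂ i j - term K (suc p₁) p₂ i j ∎
  where
  s = i ℕ.+ j
  w = weight K i j
  distrib : ∀ w k a b → w * (k * a - b) ≡ k * (w * a) - w * b
  distrib = solve-∀ ℚ-ring

-- ... and so does RHS itself: the extra row and column of the larger square carry only zeros.
RHS-recurrence : ∀ K p₁ p₂ → RHS K p₁ (suc p₂) ≡ ℕ→ℚ K * RHS K p₁ p₂ - RHS K (suc p₁) p₂
RHS-recurrence K p₁ p₂ = begin
  ∑ (suc (p₁ ℕ.+ suc p₂)) (λ i → ∑ (suc (p₁ ℕ.+ suc p₂)) (term K p₁ (suc p₂) i))
    ≡⟨ cong (λ n → ∑ (suc n) (λ i → ∑ (suc n) (term K p₁ (suc p₂) i))) (ℕₚ.+-suc p₁ p₂) ⟩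
  ∑ N (λ i → ∑ N (term K p₁ (suc p₂) i))
    ≡⟨ ∑-cong N (λ i _ → ∑-cong N (λ j _ → term-recurrence K p₁ p₂ i j)) ⟩
  ∑ N (λ i → ∑ N (λ j → ℕ→ℚ K * term K p₁ p₂ i j - term K (suc p₁) p₂ i j))
    ≡⟨ ∑-cong N (λ i _ → ∑-linear N (ℕ→ℚ K) (term K p₁ p₂ i) (term K (suc p₁) p₂ i)) ⟩
  ∑ N (λ i → ℕ→ℚ K * ∑ N (term K p₁ p₂ i) - ∑ N (term K (suc p₁) p₂ i))
    ≡⟨ ∑-linear N (ℕ→ℚ K) (λ i → ∑ N (term K p₁ p₂ i)) (λ i → ∑ N (term K (suc p₁) p₂ i)) ⟩
  ℕ→ℚ K * ∑ N (λ i → ∑ N (term K p₁ p₂ i)) - RHS K (suc p₁) p₂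
    ≡⟨ cong (λ r → ℕ→ℚ K * r - RHS K (suc p₁) p₂)
            (square-shrink (suc (p₁ ℕ.+ p₂)) (term K p₁ p₂) (λ i j → term-above K p₁ p₂ i j)) ⟩
  ℕ→ℚ K * RHS K p₁ p₂ - RHS K (suc p₁) p₂
    ∎
  where
  N = suc (suc (p₁ ℕ.+ p₂))

-- For p₂ = 0 only the diagonal i + j = p survives; there (p+1) times the summand is the
-- i-th summand of G p (K-1), by absorption (p+1) C(p,i) = C(p+1,i) (j+1).
term-diagonal : ∀ n i j →
  ℕ→ℚ (suc (i ℕ.+ j)) * term (suc n) (i ℕ.+ j) 0 i j
  ≡ suc (i ℕ.+ j) Cℚ i * sgn i * B i * ℕ→ℚ n ^ᵠ (suc (i ℕ.+ j) ∸ i)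
term-diagonal n i j = begin
  P * term (suc n) s 0 i j
    ≡⟨ cong (P *_) (term-inside (suc n) s 0 i j ℕₚ.≤-refl (ℕₚ.m≤m+n s 0)) ⟩
  P * (sgn (j ℕ.+ s) * X * ℕ→ℚ (0 C (s ∸ s)) * (B i * v) * w * ℕ→ℚ (suc n) ^ᵠ (s ℕ.+ 0 ∸ s))
    ≡⟨ cong₂ (λ a b → P * (sgn (j ℕ.+ s) * X * ℕ→ℚ (0 C a) * (B i * v) * w * ℕ→ℚ (suc n) ^ᵠ b))
             (ℕₚ.n∸n≡0 s) (ℕₚ.m+n∸m≡n s 0) ⟩
  P * (sgn (j ℕ.+ s) * X * 1ℚ * (B i * v) * w * 1ℚ)
    ≡⟨ cong (λ σ → P * (σ * X * 1ℚ * (B i * v) * w * 1ℚ)) sign ⟩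
  P * (sgn i * X * 1ℚ * (B i * v) * w * 1ℚ)
    ≡⟨ regroup P (sgn i) X (B i) v w ⟩
  P * X * v * sgn i * B i * w
    ≡⟨ cong (λ c → c * v * sgn i * B i * w) absorb ⟩
  suc s Cℚ i * ℕ→ℚ (suc j) * v * sgn i * B i * w
    ≡⟨ regroup′ (suc s Cℚ i) (ℕ→ℚ (suc j)) v (sgn i) (B i) w ⟩
  suc s Cℚ i * sgn i * B i * w * (v * ℕ→ℚ (suc j))
    ≡⟨ cong (suc s Cℚ i * sgn i * B i * w *_) (*-inverse-suc j) ⟩
  suc s Cℚ i * sgn i * B i * w * 1ℚ
    ≡⟨ ℚₚ.*-identityʳ (suc s Cℚ i * sgn i * B i * w) ⟩
  suc s Cℚ i * sgn i * B i * ℕ→ℚ n ^ᵠ suc j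
    ≡⟨ cong (λ e → suc s Cℚ i * sgn i * B i * ℕ→ℚ n ^ᵠ e) (sym P-i≡) ⟩
  suc s Cℚ i * sgn i * B i * ℕ→ℚ n ^ᵠ (suc s ∸ i)
    ∎
  where
  s = i ℕ.+ j
  P = ℕ→ℚ (suc s)
  X = s Cℚ i
  v = (⁺ 1) / suc j
  w = ℕ→ℚ n ^ᵠ suc j
  P-i≡ : suc s ∸ i ≡ suc j
  P-i≡ = trans (ℕₚ.+-∸-assoc 1 (ℕₚ.m≤m+n i j)) (cong suc (ℕₚ.m+n∸m≡n i j))
  regroup : ∀ P σ X b v w → P * (σ * X * 1ℚ * (b * v) * w * 1ℚ) ≡ P * X * v * σ * b * w
  regroup = solve-∀ ℚ-ring
  regroup′ : ∀ c m v σ b w → c * m * v * σ * b * w ≡ c * σ * b * w * (v * m)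
  regroup′ = solve-∀ ℚ-ring
  swap : ∀ a b → b * (a * b) ≡ a * (b * b)
  swap = solve-∀ ℚ-ring
  sign : sgn (j ℕ.+ s) ≡ sgn i
  sign = begin
    sgn (j ℕ.+ s)              ≡⟨ sgn-+ j s ⟩
    sgn j * sgn s              ≡⟨ cong (sgn j *_) (sgn-+ i j) ⟩
    sgn j * (sgn i * sgn j)    ≡⟨ swap (sgn i) (sgn j) ⟩
    sgn i * (sgn j * sgn j)    ≡⟨ cong (sgn i *_) (sgn-square j) ⟩
    sgn i * 1ℚ                 ≡⟨ ℚₚ.*-identityʳ (sgn i) ⟩
    sgn i                      ∎
  absorb : P * X ≡ suc s Cℚ i * ℕ→ℚ (suc j)
  absorb = begin
    P * X                                ≡⟨ sym (ℕ→ℚ-* (suc s) (s C i)) ⟩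
    ℕ→ℚ (suc s ℕ.* (s C i))              ≡⟨ cong ℕ→ℚ (sym (C-absorption (ℕₚ.m≤m+n i j))) ⟩
    ℕ→ℚ ((suc s C i) ℕ.* (suc s ∸ i))    ≡⟨ cong (λ m → ℕ→ℚ ((suc s C i) ℕ.* m)) P-i≡ ⟩
    ℕ→ℚ ((suc s C i) ℕ.* suc j)          ≡⟨ ℕ→ℚ-* (suc s C i) (suc j) ⟩
    suc s Cℚ i * ℕ→ℚ (suc j)             ∎

RHS-base : ∀ n p → ℕ→ℚ (suc p) * RHS (suc n) p 0 ≡ G p (ℕ→ℚ n)
RHS-base n p = begin
  ℕ→ℚ P * ∑ (suc (p ℕ.+ 0)) (λ i → ∑ (suc (p ℕ.+ 0)) (term (suc n) p 0 i))
    ≡⟨ cong (λ m → ℕ→ℚ P * ∑ (suc m) (λ i → ∑ (suc m) (term (suc n) p 0 i))) (ℕₚ.+-identityʳ p) ⟩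
  ℕ→ℚ P * ∑ P (λ i → ∑ P (term (suc n) p 0 i))
    ≡⟨ cong (ℕ→ℚ P *_) (∑-cong P (λ i _ →
         ∑-single P (p ∸ i) (term (suc n) p 0 i) (s≤s (ℕₚ.m∸n≤m p i))
                  (λ j _ j≢p-i → off-diagonal i j j≢p-i (ℕ.<-cmp (i ℕ.+ j) p)))) ⟩
  ℕ→ℚ P * ∑ P (λ i → term (suc n) p 0 i (p ∸ i))
    ≡⟨ ∑-*ˡ P (ℕ→ℚ P) (λ i → term (suc n) p 0 i (p ∸ i)) ⟩
  ∑ P (λ i → ℕ→ℚ P * term (suc n) p 0 i (p ∸ i))
    ≡⟨ ∑-cong P (λ i i≤p → on-diagonal i (ℕₚ.≤-pred i≤p)) ⟩
  G p (ℕ→ℚ n)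
    ∎
  where
  P = suc p
  off-diagonal : ∀ i j → j ≢ p ∸ i → Tri (i ℕ.+ j ℕ.< p) (i ℕ.+ j ≡ p) (p ℕ.< i ℕ.+ j) →
    term (suc n) p 0 i j ≡ 0ℚ
  off-diagonal i j _     (tri< s<p _ _) = term-below (suc n) p 0 i j s<p
  off-diagonal i j j≢p-i (tri≈ _ s≡p _) = ⊥-elim (j≢p-i (trans (sym (ℕₚ.m+n∸m≡n i j)) (cong (_∸ i) s≡p)))
  off-diagonal i j _     (tri> _ _ p<s) =
    term-above (suc n) p 0 i j (subst (ℕ._< i ℕ.+ j) (sym (ℕₚ.+-identityʳ p)) p<s)
  on-diagonal : ∀ i → i ℕ.≤ p →
    ℕ→ℚ P * term (suc n) p 0 i (p ∸ i) ≡ P Cℚ i * sgn i * B i * ℕ→ℚ n ^ᵠ (P ∸ i)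
  on-diagonal i i≤p =
    subst (λ q → ℕ→ℚ (suc q) * term (suc n) q 0 i (p ∸ i) ≡ suc q Cℚ i * sgn i * B i * ℕ→ℚ n ^ᵠ (suc q ∸ i))
          (ℕₚ.m+[n∸m]≡n i≤p) (term-diagonal n i (p ∸ i))

LHS-base : ∀ n p → LHS (suc n) p 0 ≡ ∑ n (λ t → ℕ→ℚ (suc t) ^ᵠ p)
LHS-base n p = ∑-cong n (λ t _ → ℚₚ.*-identityʳ (ℕ→ℚ (suc t) ^ᵠ p))

-- The case p₂ = 0 of the theorem: after multiplying by p+1 both sides are G p n (Faulhaber).
identity-base : ∀ n p → LHS (suc n) p 0 ≡ RHS (suc n) p 0
identity-base n p = *-cancelˡ-suc p (begin
  ℕ→ℚ (suc p) * LHS (suc n) p 0                       ≡⟨ cong (ℕ→ℚ (suc p) *_) (LHS-base n p) ⟩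
  ℕ→ℚ (suc p) * ∑ n (λ t → ℕ→ℚ (suc t) ^ᵠ p)          ≡⟨ sym (faulhaber⁺ p n) ⟩
  G p (ℕ→ℚ n)                                         ≡⟨ sym (RHS-base n p) ⟩
  ℕ→ℚ (suc p) * RHS (suc n) p 0                       ∎)

-- Since (K-i)^(p₂+1) = K (K-i)^p₂ - i (K-i)^p₂ (K = k + 1, i = t + 1), the left-hand side
-- satisfies the same recurrence as RHS.
LHS-recurrence : ∀ k p₁ p₂ →
  LHS (suc k) p₁ (suc p₂) ≡ ℕ→ℚ (suc k) * LHS (suc k) p₁ p₂ - LHS (suc k) (suc p₁) p₂
LHS-recurrence k p₁ p₂ = trans
  (∑-cong k (λ t t<k → summand t (ℕₚ.<⇒≤ t<k)))
  (∑-linear k (ℕ→ℚ (suc k)) (λ t → ℕ→ℚ (suc t) ^ᵠ p₁ * ℕ→ℚ (k ∸ t) ^ᵠ p₂)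
                             (λ t → ℕ→ℚ (suc t) ^ᵠ suc p₁ * ℕ→ℚ (k ∸ t) ^ᵠ p₂))
  where
  split : ∀ a y A Y → A * (y * Y) ≡ (y + a) * (A * Y) - (a * A) * Y
  split = solve-∀ ℚ-ring
  summand : ∀ t → t ℕ.≤ k →
    ℕ→ℚ (suc t) ^ᵠ p₁ * ℕ→ℚ (k ∸ t) ^ᵠ suc p₂
    ≡ ℕ→ℚ (suc k) * (ℕ→ℚ (suc t) ^ᵠ p₁ * ℕ→ℚ (k ∸ t) ^ᵠ p₂) - ℕ→ℚ (suc t) ^ᵠ suc p₁ * ℕ→ℚ (k ∸ t) ^ᵠ p₂
  summand t t≤k = trans
    (split (ℕ→ℚ (suc t)) (ℕ→ℚ (k ∸ t)) (ℕ→ℚ (suc t) ^ᵠ p₁) (ℕ→ℚ (k ∸ t) ^ᵠ p₂))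
    (cong (λ K → K * (ℕ→ℚ (suc t) ^ᵠ p₁ * ℕ→ℚ (k ∸ t) ^ᵠ p₂) - ℕ→ℚ (suc t) ^ᵠ suc p₁ * ℕ→ℚ (k ∸ t) ^ᵠ p₂)
          (trans (sym (ℕ→ℚ-+ (k ∸ t) (suc t))) (cong ℕ→ℚ (trans (ℕₚ.+-suc (k ∸ t) t) (cong suc (ℕₚ.m∸n+n≡m t≤k))))))

identity : ∀ p₂ p₁ k → LHS (suc k) p₁ p₂ ≡ RHS (suc k) p₁ p₂
identity zero     p₁ k = identity-base k p₁
identity (suc p₂) p₁ k = begin
  LHS (suc k) p₁ (suc p₂)                                          ≡⟨ LHS-recurrence k p₁ p₂ ⟩
  ℕ→ℚ (suc k) * LHS (suc k) p₁ p₂ - LHS (suc k) (suc p₁) p₂        ≡⟨ cong₂ (λ a b → ℕ→ℚ (suc k) * a - b)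
                                                                         (identity p₂ p₁ k) (identity p₂ (suc p₁) k) ⟩
  ℕ→ℚ (suc k) * RHS (suc k) p₁ p₂ - RHS (suc k) (suc p₁) p₂        ≡⟨ sym (RHS-recurrence (suc k) p₁ p₂) ⟩
  RHS (suc k) p₁ (suc p₂)                                          ∎

shiftUp : (ℕ → ℚ) → ℕ → ℚ
shiftUp c zero    = 0ℚ
shiftUp c (suc m) = c m

evalPoly-shiftUp : ∀ d c x → evalPoly (suc d) (shiftUp c) x ≡ x * evalPoly d c x
evalPoly-shiftUp d c x = begin
  ∑ (suc (suc d)) (λ m → shiftUp c m * x ^ᵠ m)   ≡⟨ ∑-shift (suc d) (λ m → shiftUp c m * x ^ᵠ m) ⟩
  0ℚ * 1ℚ + ∑ (suc d) (λ m → c m * (x * x ^ᵠ m)) ≡⟨ ℚₚ.+-identityˡ _ ⟩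
  ∑ (suc d) (λ m → c m * (x * x ^ᵠ m))           ≡⟨ ∑-cong (suc d) (λ m _ → swap (c m) x (x ^ᵠ m)) ⟩
  ∑ (suc d) (λ m → x * (c m * x ^ᵠ m))           ≡⟨ sym (∑-*ˡ (suc d) x (λ m → c m * x ^ᵠ m)) ⟩
  x * evalPoly d c x                             ∎
  where
  swap : ∀ a x u → a * (x * u) ≡ x * (a * u)
  swap = solve-∀ ℚ-ring

evalPoly-sub : ∀ d a b x → evalPoly d (λ m → a m - b m) x ≡ evalPoly d a x - evalPoly d b x
evalPoly-sub d a b x = begin
  ∑ (suc d) (λ m → (a m - b m) * x ^ᵠ m)                   ≡⟨ ∑-cong (suc d) (λ m _ → distrib (a m) (b m) (x ^ᵠ m)) ⟩
  ∑ (suc d) (λ m → a m * x ^ᵠ m - b m * x ^ᵠ m)            ≡⟨ ∑-+ (suc d) (λ m → a m * x ^ᵠ m) (λ m → - (b m * x ^ᵠ m)) ⟩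
  evalPoly d a x + ∑ (suc d) (λ m → - (b m * x ^ᵠ m))      ≡⟨ cong (evalPoly d a x +_) (sym (∑-neg (suc d) (λ m → b m * x ^ᵠ m))) ⟩
  evalPoly d a x - evalPoly d b x                          ∎
  where
  distrib : ∀ a b u → (a - b) * u ≡ a * u - b * u
  distrib = solve-∀ ℚ-ring

-- Coefficients of the power sum ∑_{t=1}^{k} t^p as a polynomial of degree p+1 in K = k+1:
-- those of F p / (p+1) (read from the top), with the constant term corrected by -0^p.
powerSumCoeff : ℕ → ℕ → ℚ
powerSumCoeff p zero    = - (0ℚ ^ᵠ p)
powerSumCoeff p (suc m) = ((⁺ 1) / suc p) * (suc p Cℚ (p ∸ m) * B (p ∸ m))

F-reversed : ∀ p x → F p x ≡ ∑ (suc p) (λ m → suc p Cℚ (p ∸ m) * B (p ∸ m) * x ^ᵠ suc m)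
F-reversed p x = trans
  (∑-reverse (suc p) (λ i → suc p Cℚ i * B i * x ^ᵠ (suc p ∸ i)))
  (∑-cong (suc p) (λ m m≤p → cong (λ e → suc p Cℚ (p ∸ m) * B (p ∸ m) * x ^ᵠ e) (exponent m (ℕₚ.≤-pred m≤p))))
  where
  exponent : ∀ m → m ℕ.≤ p → suc p ∸ (p ∸ m) ≡ suc m
  exponent m m≤p = trans (ℕₚ.+-∸-assoc 1 (ℕₚ.m∸n≤m p m)) (cong suc (ℕₚ.m∸[m∸n]≡n m≤p))

power-sum-polynomial : ∀ p k →
  ∑ k (λ t → ℕ→ℚ (suc t) ^ᵠ p) ≡ evalPoly (suc p) (powerSumCoeff p) (ℕ→ℚ (suc k))
power-sum-polynomial p k = sym (begin
  ∑ (suc (suc p)) (λ m → powerSumCoeff p m * K ^ᵠ m)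
    ≡⟨ ∑-shift (suc p) (λ m → powerSumCoeff p m * K ^ᵠ m) ⟩
  - z * 1ℚ + ∑ (suc p) (λ m → v * (suc p Cℚ (p ∸ m) * B (p ∸ m)) * K ^ᵠ suc m)
    ≡⟨ cong (- z * 1ℚ +_) (∑-cong (suc p) (λ m _ →
         ℚₚ.*-assoc v (suc p Cℚ (p ∸ m) * B (p ∸ m)) (K ^ᵠ suc m))) ⟩
  - z * 1ℚ + ∑ (suc p) (λ m → v * (suc p Cℚ (p ∸ m) * B (p ∸ m) * K ^ᵠ suc m))
    ≡⟨ cong (- z * 1ℚ +_) (sym (trans (cong (v *_) (F-reversed p K)) (∑-*ˡ (suc p) v _))) ⟩
  - z * 1ℚ + v * F p K
    ≡⟨ cong (λ f → - z * 1ℚ + v * f)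
         (trans (faulhaber p (suc k)) (cong (ℕ→ℚ (suc p) *_) (∑-shift k (λ t → ℕ→ℚ t ^ᵠ p)))) ⟩
  - z * 1ℚ + v * (ℕ→ℚ (suc p) * (z + S))
    ≡⟨ regroup z v (ℕ→ℚ (suc p)) S ⟩
  (v * ℕ→ℚ (suc p)) * (z + S) - z
    ≡⟨ cong (λ u → u * (z + S) - z) (*-inverse-suc p) ⟩
  1ℚ * (z + S) - z
    ≡⟨ cancel z S ⟩
  S ∎)
  where
  K = ℕ→ℚ (suc k)
  v = (⁺ 1) / suc p
  z = 0ℚ ^ᵠ p
  S = ∑ k (λ t → ℕ→ℚ (suc t) ^ᵠ p)
  regroup : ∀ z v P S → - z * 1ℚ + v * (P * (z + S)) ≡ (v * P) * (z + S) - z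
  regroup = solve-∀ ℚ-ring
  cancel : ∀ z S → 1ℚ * (z + S) - z ≡ S
  cancel = solve-∀ ℚ-ring

-- Coefficients of LHS (k+1) p₁ p₂ as a polynomial in K = k+1, following LHS-recurrence.
coeff : ℕ → ℕ → ℕ → ℚ
coeff p₁ zero     m = powerSumCoeff p₁ m
coeff p₁ (suc p₂) m = shiftUp (coeff p₁ p₂) m - coeff (suc p₁) p₂ m

LHS-polynomial : ∀ p₂ p₁ k →
  LHS (suc k) p₁ p₂ ≡ evalPoly (suc (p₁ ℕ.+ p₂)) (coeff p₁ p₂) (ℕ→ℚ (suc k))
LHS-polynomial zero p₁ k = begin
  LHS (suc k) p₁ 0                                       ≡⟨ LHS-base k p₁ ⟩
  ∑ k (λ t → ℕ→ℚ (suc t) ^ᵠ p₁)                          ≡⟨ power-sum-polynomial p₁ k ⟩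
  evalPoly (suc p₁) (coeff p₁ 0) (ℕ→ℚ (suc k))           ≡⟨ cong (λ d → evalPoly (suc d) (coeff p₁ 0) (ℕ→ℚ (suc k)))
                                                                 (sym (ℕₚ.+-identityʳ p₁)) ⟩
  evalPoly (suc (p₁ ℕ.+ 0)) (coeff p₁ 0) (ℕ→ℚ (suc k))   ∎
LHS-polynomial (suc p₂) p₁ k = begin
  LHS (suc k) p₁ (suc p₂)
    ≡⟨ LHS-recurrence k p₁ p₂ ⟩
  K * LHS (suc k) p₁ p₂ - LHS (suc k) (suc p₁) p₂
    ≡⟨ cong₂ (λ a b → K * a - b) (LHS-polynomial p₂ p₁ k) (LHS-polynomial p₂ (suc p₁) k) ⟩
  K * evalPoly (suc N) (coeff p₁ p₂) K - evalPoly (suc (suc N)) (coeff (suc p₁) p₂) K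
    ≡⟨ cong (_- evalPoly (suc (suc N)) (coeff (suc p₁) p₂) K) (sym (evalPoly-shiftUp (suc N) (coeff p₁ p₂) K)) ⟩
  evalPoly (suc (suc N)) (shiftUp (coeff p₁ p₂)) K - evalPoly (suc (suc N)) (coeff (suc p₁) p₂) K
    ≡⟨ sym (evalPoly-sub (suc (suc N)) (shiftUp (coeff p₁ p₂)) (coeff (suc p₁) p₂) K) ⟩
  evalPoly (suc (suc N)) (coeff p₁ (suc p₂)) K
    ≡⟨ cong (λ d → evalPoly (suc d) (coeff p₁ (suc p₂)) K) (sym (ℕₚ.+-suc p₁ p₂)) ⟩
  evalPoly (suc (p₁ ℕ.+ suc p₂)) (coeff p₁ (suc p₂)) K
    ∎
  where
  K = ℕ→ℚ (suc k)
  N = p₁ ℕ.+ p₂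

-- The top coefficient is p₁! p₂! / (p₁+p₂+1)!, a Beta integral; in particular it is nonzero.
leading-coefficient : ∀ p₂ p₁ →
  coeff p₁ p₂ (suc (p₁ ℕ.+ p₂)) * ℕ→ℚ (suc (p₁ ℕ.+ p₂) !) ≡ ℕ→ℚ (p₁ ! ℕ.* p₂ !)
leading-coefficient zero p₁ rewrite ℕₚ.+-identityʳ p₁ | ℕₚ.n∸n≡0 p₁ = begin
  v * (1ℚ * 1ℚ) * ℕ→ℚ (suc p₁ ℕ.* p₁ !)      ≡⟨ cong (v * (1ℚ * 1ℚ) *_) (ℕ→ℚ-* (suc p₁) (p₁ !)) ⟩
  v * (1ℚ * 1ℚ) * (ℕ→ℚ (suc p₁) * ℕ→ℚ (p₁ !)) ≡⟨ regroup v (ℕ→ℚ (suc p₁)) (ℕ→ℚ (p₁ !)) ⟩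
  (v * ℕ→ℚ (suc p₁)) * ℕ→ℚ (p₁ !)            ≡⟨ cong (_* ℕ→ℚ (p₁ !)) (*-inverse-suc p₁) ⟩
  1ℚ * ℕ→ℚ (p₁ !)                            ≡⟨ ℚₚ.*-identityˡ (ℕ→ℚ (p₁ !)) ⟩
  ℕ→ℚ (p₁ !)                                 ≡⟨ cong ℕ→ℚ (sym (ℕₚ.*-identityʳ (p₁ !))) ⟩
  ℕ→ℚ (p₁ ! ℕ.* 1)                           ∎
  where
  v = (⁺ 1) / suc p₁
  regroup : ∀ v P f → v * (1ℚ * 1ℚ) * (P * f) ≡ (v * P) * f
  regroup = solve-∀ ℚ-ring
leading-coefficient (suc p₂) p₁ rewrite ℕₚ.+-suc p₁ p₂ = begin
  (a - b) * ℕ→ℚ (suc M ℕ.* M !)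
    ≡⟨ cong ((a - b) *_) (ℕ→ℚ-* (suc M) (M !)) ⟩
  (a - b) * (S * ℕ→ℚ (M !))
    ≡⟨ distrib a b S (ℕ→ℚ (M !)) ⟩
  S * (a * ℕ→ℚ (M !)) - b * (S * ℕ→ℚ (M !))
    ≡⟨ cong₂ (λ u w → S * u - w) (leading-coefficient p₂ p₁)
             (trans (cong (b *_) (sym (ℕ→ℚ-* (suc M) (M !)))) (leading-coefficient p₂ (suc p₁))) ⟩
  S * ℕ→ℚ (p₁ ! ℕ.* p₂ !) - ℕ→ℚ (suc p₁ ! ℕ.* p₂ !)
    ≡⟨ cong (_- ℕ→ℚ (suc p₁ ! ℕ.* p₂ !)) (sym (ℕ→ℚ-* (suc M) (p₁ ! ℕ.* p₂ !))) ⟩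
  ℕ→ℚ (suc M ℕ.* (p₁ ! ℕ.* p₂ !)) - ℕ→ℚ (suc p₁ ! ℕ.* p₂ !)
    ≡⟨ cong (λ n → ℕ→ℚ n - ℕ→ℚ (suc p₁ ! ℕ.* p₂ !)) (split p₁ p₂ (p₁ !) (p₂ !)) ⟩
  ℕ→ℚ (suc p₁ ! ℕ.* p₂ ! ℕ.+ p₁ ! ℕ.* suc p₂ !) - ℕ→ℚ (suc p₁ ! ℕ.* p₂ !)
    ≡⟨ cong (_- ℕ→ℚ (suc p₁ ! ℕ.* p₂ !)) (ℕ→ℚ-+ (suc p₁ ! ℕ.* p₂ !) (p₁ ! ℕ.* suc p₂ !)) ⟩
  ℕ→ℚ (suc p₁ ! ℕ.* p₂ !) + ℕ→ℚ (p₁ ! ℕ.* suc p₂ !) - ℕ→ℚ (suc p₁ ! ℕ.* p₂ !)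
    ≡⟨ cancel (ℕ→ℚ (suc p₁ ! ℕ.* p₂ !)) (ℕ→ℚ (p₁ ! ℕ.* suc p₂ !)) ⟩
  ℕ→ℚ (p₁ ! ℕ.* suc p₂ !)
    ∎
  where
  M = suc (p₁ ℕ.+ p₂)
  a = coeff p₁ p₂ M
  b = coeff (suc p₁) p₂ (suc M)
  S = ℕ→ℚ (suc M)
  distrib : ∀ a b S F → (a - b) * (S * F) ≡ S * (a * F) - b * (S * F)
  distrib = solve-∀ ℚ-ring
  cancel : ∀ x y → x + y - x ≡ y
  cancel = solve-∀ ℚ-ring
  split : ∀ p₁ p₂ f₁ f₂ → suc (suc (p₁ ℕ.+ p₂)) ℕ.* (f₁ ℕ.* f₂)
                          ≡ suc p₁ ℕ.* f₁ ℕ.* f₂ ℕ.+ f₁ ℕ.* (suc p₂ ℕ.* f₂)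
  split = solve-∀ ℕ-Solver.ring

leading-coefficient≢0 : ∀ p₁ p₂ → coeff p₁ p₂ (suc (p₁ ℕ.+ p₂)) ≢ 0ℚ
leading-coefficient≢0 p₁ p₂ top≡0 = ℕ.≢-nonZero⁻¹ (p₁ ! ℕ.* p₂ !) {{p₁ ℕₚ.!* p₂ !≢0}}
  (ℕ→ℚ-reflects-0 (p₁ ! ℕ.* p₂ !) (begin
    ℕ→ℚ (p₁ ! ℕ.* p₂ !)                                         ≡⟨ sym (leading-coefficient p₂ p₁) ⟩
    coeff p₁ p₂ (suc (p₁ ℕ.+ p₂)) * ℕ→ℚ (suc (p₁ ℕ.+ p₂) !)     ≡⟨ cong (_* ℕ→ℚ (suc (p₁ ℕ.+ p₂) !)) top≡0 ⟩
    0ℚ * ℕ→ℚ (suc (p₁ ℕ.+ p₂) !)                                ≡⟨ ℚₚ.*-zeroˡ (ℕ→ℚ (suc (p₁ ℕ.+ p₂) !)) ⟩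
    0ℚ                                                          ∎))

lemma4p1 : (p₁ p₂ : ℕ) →
    ((k : ℕ) → LHS (suc k) p₁ p₂ ≡ RHS (suc k) p₁ p₂)
    × Σ (ℕ → ℚ) (λ c → (c (p₁ ℕ.+ p₂ ℕ.+ 1) ≢ 0ℚ)
        × ((k : ℕ) → RHS (suc k) p₁ p₂ ≡ evalPoly (p₁ ℕ.+ p₂ ℕ.+ 1) c (ℕ→ℚ (suc k))))
lemma4p1 p₁ p₂ = identity p₂ p₁ , coeff p₁ p₂ , top≢0 , RHS-polynomial
  where
  degree : suc (p₁ ℕ.+ p₂) ≡ p₁ ℕ.+ p₂ ℕ.+ 1
  degree = ℕₚ.+-comm 1 (p₁ ℕ.+ p₂)
  top≢0 : coeff p₁ p₂ (p₁ ℕ.+ p₂ ℕ.+ 1) ≢ 0ℚ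
  top≢0 = subst (λ d → coeff p₁ p₂ d ≢ 0ℚ) degree (leading-coefficient≢0 p₁ p₂)
  RHS-polynomial : ∀ k → RHS (suc k) p₁ p₂ ≡ evalPoly (p₁ ℕ.+ p₂ ℕ.+ 1) (coeff p₁ p₂) (ℕ→ℚ (suc k))
  RHS-polynomial k = begin
    RHS (suc k) p₁ p₂                                              ≡⟨ sym (identity p₂ p₁ k) ⟩
    LHS (suc k) p₁ p₂                                              ≡⟨ LHS-polynomial p₂ p₁ k ⟩
    evalPoly (suc (p₁ ℕ.+ p₂)) (coeff p₁ p₂) (ℕ→ℚ (suc k))         ≡⟨ cong (λ d → evalPoly d (coeff p₁ p₂) (ℕ→ℚ (suc k))) degree ⟩
    evalPoly (p₁ ℕ.+ p₂ ℕ.+ 1) (coeff p₁ p₂) (ℕ→ℚ (suc k))         ∎
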